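{- Let $r\ge 2$ and let $\mathcal{H}$ be an $r$-partite $r$-uniform intersecting hypergraph. Then at least $\big(1-\frac{r-2}{(r-1)^2}\big)\cdot |E(\mathcal{H})|$ hyperedges of $\mathcal{H}$ can be covered by a multi-colored set of size $r-1$, and this bound is sharp for infinitely many values of $r$. Moreover, the cover can be chosen so that it is a subset of some hyperedge of $\mathcal{H}$.
   Context: A hypergraph $\mathcal{H}$ has a finite vertex set and a multiset $E(\mathcal{H})$ of subsets (hyperedges), counted with multiplicity. It is $r$-uniform if every hyperedge has $r$ vertices; $r$-partite if its vertex set has a partition into $r$ nonempty classes such that no hyperedge contains two vertices from the same class; intersecting if every two hyperedges share a vertex. A set of vertices is multi-colored if it meets every class in at most one vertex. A hyperedge is covered by a set $T$ if it intersects $T$. Sharpness means that for infinitely many $r$ there exist such hypergraphs in which no multi-colored set of size $r-1$ covers more than $\big(1-\frac{r-2}{(r-1)^2}\big)\cdot |E(\mathcal{H})|$ hyperedges. -}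

module Defs where

open import Data.Nat using (ℕ; _∸_; _*_; _^_; _≤_; _≥_)
open import Data.Fin using (Fin)
open import Data.Fin.Subset using (Subset; _∈_; _⊆_; _∩_; ∣_∣; Nonempty)
open import Data.Fin.Subset.Properties using (nonempty?)
open import Data.List using (length; filter; allFin)
open import Data.Product using (∃; _×_)
open import Relation.Binary.PropositionalEquality using (_≡_)

-- A hypergraph on vertex set Fin n with m hyperedges (a multiset of
-- hyperedges, given as an indexed family E : Fin m → Subset n).
Edges : ℕ → ℕ → Set
Edges n m = Fin m → Subset n

-- A vertex colouring c : Fin n → Fin r describes a partition of the
-- vertex set into r classes (class k = c⁻¹(k)); it is a partition into
-- r NONEMPTY classes iff c is surjective.
Surjective : ∀ {n r} → (Fin n → Fin r) → Set
Surjective {n} {r} c = ∀ (k : Fin r) → ∃ λ (v : Fin n) → c v ≡ k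

MultiColored : ∀ {n r} → (Fin n → Fin r) → Subset n → Set
MultiColored c T = ∀ x y → x ∈ T → y ∈ T → c x ≡ c y → x ≡ y

Uniform : ∀ {n m} → ℕ → Edges n m → Set
Uniform r E = ∀ i → ∣ E i ∣ ≡ r

Partite : ∀ {n m r} → (Fin n → Fin r) → Edges n m → Set
Partite c E = ∀ i → MultiColored c (E i)

Intersecting : ∀ {n m} → Edges n m → Set
Intersecting E = ∀ i j → Nonempty (E i ∩ E j)

IsRPartiteRUniformIntersecting : ∀ {n m} (r : ℕ) → (Fin n → Fin r) → Edges n m → Set
IsRPartiteRUniformIntersecting r c E =
  Surjective c × Partite c E × Uniform r E × Intersecting E

-- number of hyperedges (counted with multiplicity) covered by T,
-- i.e. intersecting T
coveredCount : ∀ {n m} → Edges n m → Subset n → ℕ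
coveredCount {m = m} E T = length (filter (λ i → nonempty? (E i ∩ T)) (allFin m))

-- "k ≥ (1 - (r-2)/(r-1)^2) · m", cleared of denominators (valid for r ≥ 2):
--   k · (r-1)^2 ≥ ((r-1)^2 - (r-2)) · m
AtLeastBound : ℕ → ℕ → ℕ → Set
AtLeastBound r m k = ((r ∸ 1) ^ 2 ∸ (r ∸ 2)) * m ≤ k * (r ∸ 1) ^ 2

-- "k ≤ (1 - (r-2)/(r-1)^2) · m", cleared of denominators
AtMostBound : ℕ → ℕ → ℕ → Set
AtMostBound r m k = k * (r ∸ 1) ^ 2 ≤ ((r ∸ 1) ^ 2 ∸ (r ∸ 2)) * m

module Submission where

-- Write s = r - 1. The cover is E i - u for a hyperedge E i and a vertex u ∈ E i: every
-- hyperedge meets E i, so it misses exactly the onlyAt i u hyperedges meeting E i in u alone,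
-- and it suffices to find (i, u) with s² · onlyAt i u ≤ (s - 1) · m. Suppose no pair is that
-- good. The degrees of the vertices of colour zero add up to m, so one of them, v of degree d,
-- has d ≥ m / s or d ≤ m / (s + 1). Summing the assumption over the pairs (i, u) with v ∈ E i
-- bounds D = Σ_{v ∈ E i} onlyAt i v and W = Σ_{v ∈ E i} Σ_{u ∈ E i - v} onlyAt i u from below.
-- From above, W is at most d times the number N = m - d of hyperedges E j avoiding v, which
-- already refutes d ≥ m / s; and for each such E j, double counting the pairs of hyperedges
-- through v together with Cauchy–Schwarz over the s vertices of E j outside the colour of v
-- gives s D + t_j² ≤ s d², where t_j counts the pairs (i, u) above with E j meeting E i in u
-- alone, so that W = Σ_j t_j. Summed with Cauchy–Schwarz once more, this is incompatible with
-- the lower bounds when d ≤ m / (s + 1).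
--
-- For sharpness take a prime p and the dual of the affine plane over ℤ/p: the p² points are
-- the hyperedges and the lines are the vertices, coloured by their p + 1 directions. Two points
-- span a line, two lines of distinct directions meet, and each line has p points, so a
-- multi-colored set of p lines covers at most p + (p - 1)² = (1 - (p - 1)/p²) p² points.

open import Defs
open import Data.Nat using (ℕ; _∸_; _≥_)
open import Data.Fin using (Fin)
open import Data.Fin.Subset using (Subset; _⊆_; ∣_∣)
open import Data.Product using (Σ; ∃; _×_)
open import Relation.Binary.PropositionalEquality using (_≡_)

open import Data.Bool.Base using (true; false; if_then_else_)
open import Data.Empty using (⊥; ⊥-elim)
open import Data.Fin.Base using (zero; suc; toℕ; fromℕ; fromℕ<; combine; remQuot; _↑ˡ_; _↑ʳ_)
import Data.Fin.Properties
open Data.Fin.Properties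
  using (any?; nonZeroIndex; toℕ-injective; toℕ<n; toℕ-fromℕ; toℕ-fromℕ<; remQuot-combine; combine-remQuot)
  renaming (_≟_ to _≟ᶠ_)
open import Data.Fin.Subset using (outside; inside; _∈_; _∉_; _∩_; ⁅_⁆; _─_; _-_; Nonempty)
open import Data.Fin.Subset.Properties
  using (_∈?_; _⊆?_; nonempty?; x∈p∩q⁺; x∈p∩q⁻; p─⊥≡p; p─q⊆p; x∈⁅x⁆; x∈⁅y⁆⇒x≡y; x∈p∧x≢y⇒x∈p-y)
import Data.List.Base as List
import Data.List.Relation.Unary.All as All
open import Data.Nat.Base
  using (zero; suc; _+_; _*_; _^_; _!; _≤_; _<_; z≤n; s≤s; >-nonZero; >-nonZero⁻¹; ≢-nonZero⁻¹; nonTrivial⇒n>1)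
open import Data.Nat.Properties
open import Data.Product.Base using (_,_; proj₁; proj₂; ∃₂)
open import Function.Base using (_∘_)
open import Data.Vec.Base using ([]; _∷_; here; there)
import Data.Vec.Base as Vec
open import Data.Vec.Properties using (lookup∘tabulate; []=⇒lookup; lookup⇒[]=)
open import Data.Sum.Base using (_⊎_; inj₁; inj₂; [_,_]′)
open import Relation.Binary.PropositionalEquality
  using (_≢_; refl; sym; trans; cong; cong₂; subst; subst₂; module ≡-Reasoning)
open import Relation.Nullary using (Dec; yes; no; does; ¬_; _×-dec_; _⊎-dec_; ¬?)
open import Relation.Unary using (Pred; Decidable)
open import Relation.Nullary.Decidable using (dec-true; does-⇔)
open import Function.Bundles using (mk⇔)
open import Algebra.Properties.Semiring.Sum +-*-semiring
  using (sum; sum-cong-≗; *-distribˡ-sum; *-distribʳ-sum)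
open import Algebra.Properties.CommutativeSemigroup +-commutativeSemigroup using (interchange)
open import Data.Nat.Tactic.RingSolver using (solve-∀)
open import Data.Nat.DivMod using (_%_; %-distribˡ-+; %-distribˡ-*; m%n%n≡m%n; [m+kn]%n≡m%n; m<n⇒m%n≡m; m%n<n)
open import Data.Nat.Primality using (Prime; prime⇒nonZero; prime⇒nonTrivial)
open import Data.Nat.Primality.Factorisation using (factorise)
open import Data.Nat.Divisibility using (_∣_; ∣-trans; n∣m*n; m∣m*n; m≤n⇒m!∣n!; ∣m+n∣m⇒∣n; ∣1⇒≡1)
open import Data.Nat.ListAction using (product)
open import Data.Nat.Coprimality using (prime⇒coprime; coprime-Bézout)
open import Data.Nat.GCD using (module Bézout)

-- Indicators and finite sums

𝟙 : ∀ {a} {P : Set a} → Dec P → ℕ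
𝟙 d = if does d then 1 else 0

module _ {a} {P : Set a} where

  𝟙-elim : (d : Dec P) (C : ℕ → Set) → (P → C 1) → (¬ P → C 0) → C (𝟙 d)
  𝟙-elim (yes pr) C c₁ _  = c₁ pr
  𝟙-elim (no ¬P)  C _  c₀ = c₀ ¬P

  𝟙≤1 : (d : Dec P) → 𝟙 d ≤ 1
  𝟙≤1 (yes _) = ≤-refl
  𝟙≤1 (no _)  = z≤n

  𝟙-yes : (d : Dec P) → P → 𝟙 d ≡ 1
  𝟙-yes (yes _) _  = refl
  𝟙-yes (no ¬P) pr = ⊥-elim (¬P pr)

  𝟙>0⇒ : (d : Dec P) → 0 < 𝟙 d → P
  𝟙>0⇒ (yes pr) _ = pr

  𝟙-¬ : (d : Dec P) → 𝟙 d + 𝟙 (¬? d) ≡ 1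
  𝟙-¬ (yes _) = refl
  𝟙-¬ (no _)  = refl

  𝟙*-monoʳ-≤ : (d : Dec P) {x y : ℕ} → (P → x ≤ y) → 𝟙 d * x ≤ 𝟙 d * y
  𝟙*-monoʳ-≤ (yes pr) x≤y = +-monoˡ-≤ 0 (x≤y pr)
  𝟙*-monoʳ-≤ (no _)   _   = z≤n

  𝟙*>0⇒ : (d : Dec P) {x : ℕ} → 0 < 𝟙 d * x → P × 0 < x
  𝟙*>0⇒ (yes pr) {suc _} _ = pr , s≤s z≤n

  𝟙*≤ : (d : Dec P) (x : ℕ) → 𝟙 d * x ≤ x
  𝟙*≤ d x = ≤-trans (*-monoˡ-≤ x (𝟙≤1 d)) (≤-reflexive (*-identityˡ x))

  𝟙*-identity : (d : Dec P) {x : ℕ} → (0 < x → P) → 𝟙 d * x ≡ x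
  𝟙*-identity (yes _)  {x}     _   = +-identityʳ x
  𝟙*-identity (no _)   {zero}  _   = refl
  𝟙*-identity (no ¬P)  {suc _} x⇒P = ⊥-elim (¬P (x⇒P (s≤s z≤n)))

𝟙-× : ∀ {a b} {P : Set a} {Q : Set b} (d : Dec P) (e : Dec Q) → 𝟙 (d ×-dec e) ≡ 𝟙 d * 𝟙 e
𝟙-× (yes _) (yes _) = refl
𝟙-× (yes _) (no _)  = refl
𝟙-× (no _)  _       = refl

𝟙-cong : ∀ {a b} {P : Set a} {Q : Set b} (d : Dec P) (e : Dec Q) → (P → Q) → (Q → P) → 𝟙 d ≡ 𝟙 e
𝟙-cong d e P⇒Q Q⇒P = cong (λ b → if b then 1 else 0) (does-⇔ (mk⇔ P⇒Q Q⇒P) d e)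

𝟙*𝟙≤1 : ∀ {a b} {P : Set a} {Q : Set b} (d : Dec P) (e : Dec Q) → 𝟙 d * 𝟙 e ≤ 1
𝟙*𝟙≤1 d e = subst (_≤ 1) (𝟙-× d e) (𝟙≤1 (d ×-dec e))

𝟙*𝟙>0⇒ : ∀ {a b} {P : Set a} {Q : Set b} (d : Dec P) (e : Dec Q) → 0 < 𝟙 d * 𝟙 e → P × Q
𝟙*𝟙>0⇒ d e pos = 𝟙>0⇒ (d ×-dec e) (subst (0 <_) (sym (𝟙-× d e)) pos)

*>0⇒ : ∀ a b → 0 < a * b → 0 < a × 0 < b
*>0⇒ (suc a) zero    ab>0 = ⊥-elim (n≮0 (subst (0 <_) (*-zeroʳ a) ab>0))
*>0⇒ (suc a) (suc b) _    = s≤s z≤n , s≤s z≤n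

+>0⇒ : ∀ {a b} → 0 < a + b → 0 < a ⊎ 0 < b
+>0⇒ {suc _} _   = inj₁ (s≤s z≤n)
+>0⇒ {zero}  pos = inj₂ pos

≤1∧>0⇒≤ : ∀ {x y} → x ≤ 1 → (0 < x → 0 < y) → x ≤ y
≤1∧>0⇒≤ {zero}  _       _   = z≤n
≤1∧>0⇒≤ {suc _} (s≤s z≤n) pos = pos (s≤s z≤n)

s*m≡m+[s∸1]*m : ∀ s m → 0 < s → s * m ≡ m + (s ∸ 1) * m
s*m≡m+[s∸1]*m (suc _) m _ = refl

sum-mono-≤ : ∀ {n} {f g : Fin n → ℕ} → (∀ i → f i ≤ g i) → sum f ≤ sum g
sum-mono-≤ {zero}  _ = z≤n
sum-mono-≤ {suc _} h = +-mono-≤ (h zero) (sum-mono-≤ (λ i → h (suc i)))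

sum-distrib-+ : ∀ {n} (f g : Fin n → ℕ) → sum (λ i → f i + g i) ≡ sum f + sum g
sum-distrib-+ {zero}  f g = refl
sum-distrib-+ {suc n} f g = begin
  f zero + g zero + sum (λ i → f (suc i) + g (suc i))
    ≡⟨ cong (f zero + g zero +_) (sum-distrib-+ (λ i → f (suc i)) (λ i → g (suc i))) ⟩
  f zero + g zero + (sum (λ i → f (suc i)) + sum (λ i → g (suc i)))
    ≡⟨ interchange (f zero) (g zero) _ _ ⟩
  f zero + sum (λ i → f (suc i)) + (g zero + sum (λ i → g (suc i))) ∎
  where open ≡-Reasoning

sum-const : ∀ n k → sum {n} (λ _ → k) ≡ n * k
sum-const zero    k = refl
sum-const (suc n) k = cong (k +_) (sum-const n k)

sum-zero : ∀ {n} {f : Fin n → ℕ} → (∀ i → f i ≡ 0) → sum f ≡ 0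
sum-zero {n} h = trans (sum-cong-≗ h) (trans (sum-const n 0) (*-zeroʳ n))

sum≡0 : ∀ {n} {f : Fin n → ℕ} → (∀ i → ¬ 0 < f i) → sum f ≡ 0
sum≡0 h = sum-zero (λ i → n≤0⇒n≡0 (≮⇒≥ (h i)))

sum-swap : ∀ {m n} (f : Fin m → Fin n → ℕ) → sum (λ i → sum (f i)) ≡ sum (λ j → sum (λ i → f i j))
sum-swap {zero}  {n} f = sym (sum-zero {n} (λ _ → refl))
sum-swap {suc m} {n} f = begin
  sum (f zero) + sum (λ i → sum (f (suc i)))
    ≡⟨ cong (sum (f zero) +_) (sum-swap (λ i → f (suc i))) ⟩
  sum (f zero) + sum (λ j → sum (λ i → f (suc i) j))
    ≡⟨ sym (sum-distrib-+ (f zero) (λ j → sum (λ i → f (suc i) j))) ⟩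
  sum (λ j → f zero j + sum (λ i → f (suc i) j)) ∎
  where open ≡-Reasoning

sum-*-sum : ∀ {m n} (f : Fin m → ℕ) (g : Fin n → ℕ) → sum f * sum g ≡ sum (λ i → sum (λ j → f i * g j))
sum-*-sum f g = trans (*-distribʳ-sum (sum g) f) (sum-cong-≗ (λ i → *-distribˡ-sum (f i) g))

f≤sum : ∀ {n} (f : Fin n → ℕ) i → f i ≤ sum f
f≤sum f zero    = m≤m+n (f zero) _
f≤sum f (suc i) = ≤-trans (f≤sum (λ j → f (suc j)) i) (m≤n+m _ (f zero))

sum>0⇒∃ : ∀ {n} (f : Fin n → ℕ) → 0 < sum f → ∃ λ i → 0 < f i
sum>0⇒∃ {suc n} f pos with f zero in eq
... | suc _ = zero , subst (0 <_) (sym eq) (s≤s z≤n)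
... | zero  with sum>0⇒∃ (λ i → f (suc i)) pos
...   | i , fi>0 = suc i , fi>0

sum-≤1 : ∀ {n} (f : Fin n → ℕ) → (∀ i → f i ≤ 1) → (∀ i j → 0 < f i → 0 < f j → i ≡ j) → sum f ≤ 1
sum-≤1 {zero}  f _   _    = z≤n
sum-≤1 {suc n} f f≤1 uniq with f zero in eq
... | zero  = sum-≤1 (λ i → f (suc i)) (λ i → f≤1 (suc i))
                (λ i j p q → Data.Fin.Properties.suc-injective (uniq (suc i) (suc j) p q))
... | suc k = begin
  suc k + sum (λ i → f (suc i)) ≡⟨ cong (suc k +_) (sum-zero rest≡0) ⟩
  suc k + 0                     ≡⟨ +-identityʳ (suc k) ⟩
  suc k                         ≡⟨ sym eq ⟩
  f zero                        ≤⟨ f≤1 zero ⟩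
  1                             ∎
  where
  open ≤-Reasoning
  rest≡0 : ∀ i → f (suc i) ≡ 0
  rest≡0 i with f (suc i) in eqᵢ
  ... | zero  = refl
  ... | suc _ with uniq zero (suc i) (subst (0 <_) (sym eq) (s≤s z≤n)) (subst (0 <_) (sym eqᵢ) (s≤s z≤n))
  ...   | ()

sum-δ : ∀ {n} (i : Fin n) (f : Fin n → ℕ) → sum (λ j → 𝟙 (j ≟ᶠ i) * f j) ≡ f i
sum-δ {suc n} zero    f = begin
  f zero + 0 + sum (λ j → 𝟙 (suc j ≟ᶠ zero) * f (suc j)) ≡⟨ cong₂ _+_ (+-identityʳ (f zero)) (sum-zero {n} (λ j → refl)) ⟩
  f zero + 0                                              ≡⟨ +-identityʳ (f zero) ⟩
  f zero                                                  ∎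
  where open ≡-Reasoning
sum-δ {suc n} (suc i) f = sum-δ i (λ j → f (suc j))

sum-𝟙≟ : ∀ {n} (i : Fin n) → sum (λ j → 𝟙 (j ≟ᶠ i)) ≡ 1
sum-𝟙≟ i = trans (sum-cong-≗ (λ j → sym (*-identityʳ (𝟙 (j ≟ᶠ i))))) (sum-δ i (λ _ → 1))

sum-↑ : ∀ a {b} (f : Fin (a + b) → ℕ) → sum f ≡ sum (λ i → f (i ↑ˡ b)) + sum (λ j → f (a ↑ʳ j))
sum-↑ zero    f = refl
sum-↑ (suc a) f = trans (cong (f zero +_) (sum-↑ a (λ i → f (suc i)))) (sym (+-assoc (f zero) _ _))

sum-combine : ∀ a b (f : Fin (a * b) → ℕ) → sum f ≡ sum (λ i → sum (λ j → f (combine {a} {b} i j)))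
sum-combine zero    b f = refl
sum-combine (suc a) b f = trans (sum-↑ b f) (cong (sum (λ j → f (j ↑ˡ (a * b))) +_) (sum-combine a b (λ k → f (b ↑ʳ k))))

𝟙-≟-sym : ∀ {n} (i j : Fin n) → 𝟙 (i ≟ᶠ j) ≡ 𝟙 (j ≟ᶠ i)
𝟙-≟-sym i j = 𝟙-cong (i ≟ᶠ j) (j ≟ᶠ i) sym sym

sum≡n⇒all≡1 : ∀ {n} (f : Fin n → ℕ) → (∀ i → f i ≤ 1) → sum f ≡ n → ∀ i → f i ≡ 1
sum≡n⇒all≡1 {suc n} f f≤1 sum≡ i = go i
  where
  rest≤n : sum (λ i → f (suc i)) ≤ n
  rest≤n = ≤-trans (sum-mono-≤ (λ i → f≤1 (suc i))) (≤-reflexive (trans (sum-const n 1) (*-identityʳ n)))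
  head≡1 : f zero ≡ 1
  head≡1 = ≤-antisym (f≤1 zero) (+-cancelʳ-≤ n 1 (f zero) (begin
    suc n                             ≡⟨ sym sum≡ ⟩
    f zero + sum (λ i → f (suc i))    ≤⟨ +-monoʳ-≤ (f zero) rest≤n ⟩
    f zero + n                        ∎))
    where open ≤-Reasoning
  go : ∀ i → f i ≡ 1
  go zero    = head≡1
  go (suc i) = sum≡n⇒all≡1 (λ i → f (suc i)) (λ i → f≤1 (suc i))
                 (suc-injective (trans (cong (_+ sum (λ i → f (suc i))) (sym head≡1)) sum≡)) i

2ab≤a²+b² : ∀ a b → 2 * (a * b) ≤ a * a + b * b
2ab≤a²+b² a b = [ ordered , (λ b≤a → subst₂ _≤_ (cong (2 *_) (*-comm b a)) (+-comm (b * b) (a * a)) (ordered b≤a)) ]′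
                  (≤-total a b)
  where
  ordered : ∀ {a b} → a ≤ b → 2 * (a * b) ≤ a * a + b * b
  ordered {a} a≤b with m≤n⇒∃[o]m+o≡n a≤b
  ... | c , refl = subst₂ _≤_ (sym (lhs a c)) (sym (rhs a c)) (m≤m+n _ (c * c))
    where
    lhs : ∀ a c → 2 * (a * (a + c)) ≡ 2 * (a * a) + 2 * (a * c)
    lhs = solve-∀
    rhs : ∀ a c → a * a + (a + c) * (a + c) ≡ 2 * (a * a) + 2 * (a * c) + c * c
    rhs = solve-∀

cauchy-schwarz : ∀ {n} (h f : Fin n → ℕ) →
  sum (λ i → h i * f i) * sum (λ i → h i * f i) ≤ sum h * sum (λ i → h i * (f i * f i))
cauchy-schwarz {n} h f = *-cancelˡ-≤ 2 (begin
  2 * (sum hf * sum hf)                                 ≡⟨ cong (2 *_) (sum-*-sum hf hf) ⟩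
  2 * sum (λ i → sum (λ j → hf i * hf j))               ≡⟨ *-distribˡ-sum 2 (λ i → sum (λ j → hf i * hf j)) ⟩
  sum (λ i → 2 * sum (λ j → hf i * hf j))               ≡⟨ sum-cong-≗ (λ i → *-distribˡ-sum 2 (λ j → hf i * hf j)) ⟩
  sum (λ i → sum (λ j → 2 * (hf i * hf j)))             ≤⟨ sum-mono-≤ (λ i → sum-mono-≤ (termwise i)) ⟩
  sum (λ i → sum (λ j → hff i * h j + h i * hff j))
                                   ≡⟨ sum-cong-≗ (λ i → sum-distrib-+ (λ j → hff i * h j) (λ j → h i * hff j)) ⟩
  sum (λ i → sum (λ j → hff i * h j) + sum (λ j → h i * hff j))
                                   ≡⟨ sum-distrib-+ (λ i → sum (λ j → hff i * h j)) (λ i → sum (λ j → h i * hff j)) ⟩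
  sum (λ i → sum (λ j → hff i * h j)) + sum (λ i → sum (λ j → h i * hff j))
                                                        ≡⟨ cong₂ _+_ (sym (sum-*-sum hff h)) (sym (sum-*-sum h hff)) ⟩
  sum hff * sum h + sum h * sum hff                     ≡⟨ double (sum hff) (sum h) ⟩
  2 * (sum h * sum hff)                                 ∎)
  where
  open ≤-Reasoning
  hf hff : Fin n → ℕ
  hf i = h i * f i
  hff i = h i * (f i * f i)
  termwise : ∀ i j → 2 * (hf i * hf j) ≤ hff i * h j + h i * hff j
  termwise i j = subst₂ _≤_ (sym (lhs (h i) (h j) (f i) (f j))) (sym (rhs (h i) (h j) (f i) (f j)))
                   (*-monoʳ-≤ (h i * h j) (2ab≤a²+b² (f i) (f j)))
    where
    lhs : ∀ a b x y → 2 * (a * x * (b * y)) ≡ a * b * (2 * (x * y))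
    lhs = solve-∀
    rhs : ∀ a b x y → a * (x * x) * b + a * (b * (y * y)) ≡ a * b * (x * x + y * y)
    rhs = solve-∀
  double : ∀ x y → x * y + y * x ≡ 2 * (y * x)
  double = solve-∀

-- Subsets

∣p∣≡sum𝟙∈ : ∀ {n} (p : Subset n) → ∣ p ∣ ≡ sum (λ x → 𝟙 (x ∈? p))
∣p∣≡sum𝟙∈ []            = refl
∣p∣≡sum𝟙∈ (inside  ∷ p) = cong suc (∣p∣≡sum𝟙∈ p)
∣p∣≡sum𝟙∈ (outside ∷ p) = ∣p∣≡sum𝟙∈ p

suc∣p-x∣≡∣p∣ : ∀ {n} {p : Subset n} {x} → x ∈ p → suc ∣ p - x ∣ ≡ ∣ p ∣
suc∣p-x∣≡∣p∣ {p = inside  ∷ p} here        = cong (suc ∘ ∣_∣) (p─⊥≡p p)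
suc∣p-x∣≡∣p∣ {p = inside  ∷ p} (there x∈p) = cong suc (suc∣p-x∣≡∣p∣ x∈p)
suc∣p-x∣≡∣p∣ {p = outside ∷ p} (there x∈p) = suc∣p-x∣≡∣p∣ x∈p

x∈p─q⇒x∉q : ∀ {n} {p q : Subset n} {x} → x ∈ p ─ q → x ∉ q
x∈p─q⇒x∉q {p = _ ∷ _} {outside ∷ _} (there x∈) (there x∈q) = x∈p─q⇒x∉q x∈ x∈q
x∈p─q⇒x∉q {p = _ ∷ _} {inside  ∷ _} (there x∈) (there x∈q) = x∈p─q⇒x∉q x∈ x∈q

x∈p-y⇒x≢y : ∀ {n} {p : Subset n} {x y} → x ∈ p - y → x ≢ y
x∈p-y⇒x≢y {y = y} x∈ refl = x∈p─q⇒x∉q x∈ (x∈⁅x⁆ y)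

∣p∣≡1⇒x≡y : ∀ {n} {p : Subset n} {x y} → ∣ p ∣ ≡ 1 → x ∈ p → y ∈ p → x ≡ y
∣p∣≡1⇒x≡y {p = p} {x} {y} ∣p∣≡1 x∈p y∈p with y ≟ᶠ x
... | yes y≡x = sym y≡x
... | no  y≢x = ⊥-elim (0≢1+n (suc-injective (begin
  1                      ≡⟨ sym ∣p∣≡1 ⟩
  ∣ p ∣                  ≡⟨ sym (suc∣p-x∣≡∣p∣ x∈p) ⟩
  suc ∣ p - x ∣          ≡⟨ cong suc (sym (suc∣p-x∣≡∣p∣ (x∈p∧x≢y⇒x∈p-y y∈p y≢x))) ⟩
  suc (suc ∣ p - x - y ∣) ∎)))
  where open ≡-Reasoning

length-filter-tabulate : ∀ {a ℓ} {A : Set a} {P : Pred A ℓ} (P? : Decidable P) {m} (f : Fin m → A) →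
  List.length (List.filter P? (List.tabulate f)) ≡ sum (λ i → 𝟙 (P? (f i)))
length-filter-tabulate P? {zero}  f = refl
length-filter-tabulate P? {suc m} f with does (P? (f zero))
... | true  = cong suc (length-filter-tabulate P? (f ∘ suc))
... | false = length-filter-tabulate P? (f ∘ suc)

coveredCount≡sum : ∀ {n m} (E : Edges n m) (T : Subset n) →
  coveredCount E T ≡ sum (λ i → 𝟙 (nonempty? (E i ∩ T)))
coveredCount≡sum E T = length-filter-tabulate (λ i → nonempty? (E i ∩ T)) (λ i → i)

subset : ∀ {n ℓ} {P : Pred (Fin n) ℓ} → Decidable P → Subset n
subset P? = Vec.tabulate (does ∘ P?)

module _ {n ℓ} {P : Pred (Fin n) ℓ} (P? : Decidable P) where

  ∈-subset⁺ : ∀ {x} → P x → x ∈ subset P?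
  ∈-subset⁺ {x} Px = lookup⇒[]= x (subset P?) (trans (lookup∘tabulate (does ∘ P?) x) (dec-true (P? x) Px))

  ∈-subset⁻ : ∀ {x} → x ∈ subset P? → P x
  ∈-subset⁻ {x} x∈ with P? x | trans (sym ([]=⇒lookup x∈)) (lookup∘tabulate (does ∘ P?) x)
  ... | yes Px | _ = Px

  ∣subset∣ : ∣ subset P? ∣ ≡ sum (λ x → 𝟙 (P? x))
  ∣subset∣ = trans (∣p∣≡sum𝟙∈ (subset P?)) (sum-cong-≗ (λ x → 𝟙-cong (x ∈? subset P?) (P? x) ∈-subset⁻ ∈-subset⁺))

-- The lower bound

∃-positive-term-outside : ∀ {n} s m (w : Fin n → ℕ) → 0 < s → 0 < m → sum w ≡ m →
  ∃ λ x → 0 < w x × (m ≤ s * w x ⊎ suc s * w x ≤ m)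
∃-positive-term-outside s m w s>0 m>0 sum≡m
  with any? (λ x → (0 <? w x) ×-dec ((m ≤? s * w x) ⊎-dec (suc s * w x ≤? m)))
... | yes found = found
... | no ∄ = ⊥-elim (contradiction (Q ≤? s))
  where
  q : _ → ℕ
  q x = 𝟙 (0 <? w x)
  Q = sum q
  inside-interval : ∀ x → 0 < w x → s * w x < m × m < suc s * w x
  inside-interval x wx>0 = ≰⇒> (λ m≤ → ∄ (x , wx>0 , inj₁ m≤)) , ≰⇒> (λ ≤m → ∄ (x , wx>0 , inj₂ ≤m))
  lower : ∀ x → s * w x + q x ≤ m * q x
  lower x = 𝟙-elim (0 <? w x) (λ b → s * w x + b ≤ m * b)
    (λ wx>0 → subst₂ _≤_ (+-comm 1 (s * w x)) (sym (*-identityʳ m)) (proj₁ (inside-interval x wx>0)))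
    (λ wx≯0 → subst (λ z → s * z + 0 ≤ m * 0) (sym (n≤0⇒n≡0 (≮⇒≥ wx≯0)))
                (≤-reflexive (trans (cong (_+ 0) (*-zeroʳ s)) (sym (*-zeroʳ m)))))
  upper : ∀ x → suc m * q x ≤ suc s * w x
  upper x = 𝟙-elim (0 <? w x) (λ b → suc m * b ≤ suc s * w x)
    (λ wx>0 → subst (_≤ suc s * w x) (sym (*-identityʳ (suc m))) (proj₂ (inside-interval x wx>0)))
    (λ _ → subst (_≤ suc s * w x) (sym (*-zeroʳ (suc m))) z≤n)
  sm+Q≤mQ : s * m + Q ≤ m * Q
  sm+Q≤mQ = begin
    s * m + Q                   ≡⟨ cong (λ z → s * z + Q) (sym sum≡m) ⟩
    s * sum w + Q               ≡⟨ cong (_+ Q) (*-distribˡ-sum s w) ⟩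
    sum (λ x → s * w x) + Q     ≡⟨ sym (sum-distrib-+ (λ x → s * w x) q) ⟩
    sum (λ x → s * w x + q x)   ≤⟨ sum-mono-≤ lower ⟩
    sum (λ x → m * q x)         ≡⟨ sym (*-distribˡ-sum m q) ⟩
    m * Q                       ∎
    where open ≤-Reasoning
  [m+1]Q≤[s+1]m : suc m * Q ≤ suc s * m
  [m+1]Q≤[s+1]m = begin
    suc m * Q                   ≡⟨ *-distribˡ-sum (suc m) q ⟩
    sum (λ x → suc m * q x)     ≤⟨ sum-mono-≤ upper ⟩
    sum (λ x → suc s * w x)     ≡⟨ sym (*-distribˡ-sum (suc s) w) ⟩
    suc s * sum w               ≡⟨ cong (suc s *_) sum≡m ⟩
    suc s * m                   ∎
    where open ≤-Reasoning
  contradiction : Dec (Q ≤ s) → ⊥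
  contradiction (yes Q≤s) = <-irrefl refl (begin-strict
    s * m           <⟨ m<m+n (s * m) (positive Q≤s) ⟩
    s * m + Q       ≤⟨ sm+Q≤mQ ⟩
    m * Q           ≤⟨ *-monoʳ-≤ m Q≤s ⟩
    m * s           ≡⟨ *-comm m s ⟩
    s * m           ∎)
    where
    open ≤-Reasoning
    positive : Q ≤ s → 0 < Q
    positive Q≤s with Q in eq
    ... | suc _ = s≤s z≤n
    ... | zero  = ⊥-elim (<-irrefl refl (begin-strict
      0             <⟨ *-mono-< s>0 m>0 ⟩
      s * m         ≡⟨ sym (+-identityʳ (s * m)) ⟩
      s * m + 0     ≡⟨ cong (s * m +_) (sym eq) ⟩
      s * m + Q     ≤⟨ sm+Q≤mQ ⟩
      m * Q         ≡⟨ cong (m *_) eq ⟩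
      m * 0         ≡⟨ *-zeroʳ m ⟩
      0             ∎))
  contradiction (no Q≰s) = <-irrefl refl (begin-strict
    suc s * suc m   ≤⟨ *-monoˡ-≤ (suc m) (≰⇒> Q≰s) ⟩
    Q * suc m       ≡⟨ *-comm Q (suc m) ⟩
    suc m * Q       ≤⟨ [m+1]Q≤[s+1]m ⟩
    suc s * m       <⟨ *-monoʳ-< (suc s) (n<1+n m) ⟩
    suc s * suc m   ∎)
    where open ≤-Reasoning

-- With s = 2 + t and N = s d + K, the difference of the two sides is a polynomial in t, d, K
-- with nonnegative coefficients.
s³dN²≤sN²Y+dY² : ∀ t d K → let s = 2 + t; N = s * d + K; Y = (1 + t) * (d + N) in
  s * s * s * d * (N * N) ≤ s * (N * N) * Y + d * (Y * Y)
s³dN²≤sN²Y+dY² t d K = ≤-trans (m≤m+n _ _) (≤-reflexive (sym (expansion t d K)))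
  where
  expansion : ∀ t d K →
    (2 + t) * (((2 + t) * d + K) * ((2 + t) * d + K)) * ((1 + t) * (d + ((2 + t) * d + K)))
    + d * (((1 + t) * (d + ((2 + t) * d + K))) * ((1 + t) * (d + ((2 + t) * d + K))))
    ≡ (2 + t) * (2 + t) * (2 + t) * d * (((2 + t) * d + K) * ((2 + t) * d + K))
     + (2 * K * K * K + 7 * d * K * K + 6 * d * d * K + d * d * d
       + t * (3 * K * K * K + 17 * d * K * K + 26 * d * d * K + 12 * d * d * d)
       + t * t * (K * K * K + 11 * d * K * K + 26 * d * d * K + 16 * d * d * d)
       + t * t * t * (2 * d * K * K + 9 * d * d * K + 7 * d * d * d)
       + t * t * t * t * (d * d * K + d * d * d))
  expansion = solve-∀

light-pivot-absurd : ∀ {s m} d N D W → 2 ≤ s → 0 < d → d + N ≡ m → s * d ≤ N →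
  d * suc ((s ∸ 1) * m) ≤ s * s * D → d * suc ((s ∸ 1) * m) ≤ s * W →
  N * N * (s * D) + W * W ≤ N * N * (s * (d * d)) → ⊥
light-pivot-absurd {suc (suc t)} d N D W (s≤s (s≤s z≤n)) d>0 refl sd≤N dY≤s²D dY≤sW N²sD+W²≤N²sd²
  with m≤n⇒∃[o]m+o≡n sd≤N
... | K , refl = <-irrefl refl (begin-strict
  s * s * s * d * (N * N)                              <⟨ m<n+m _ sN²>0 ⟩
  s * (N * N) + s * s * s * d * (N * N)                ≤⟨ +-monoʳ-≤ (s * (N * N)) (s³dN²≤sN²Y+dY² t d K) ⟩
  s * (N * N) + (s * (N * N) * Y₀ + d * (Y₀ * Y₀))      ≡⟨ shift-1 (s * (N * N)) Y₀ d ⟩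
  s * (N * N) * Y + d * (Y₀ * Y₀)
    ≤⟨ +-monoʳ-≤ (s * (N * N) * Y) (*-monoʳ-≤ d (*-mono-≤ (n≤1+n Y₀) (n≤1+n Y₀))) ⟩
  s * (N * N) * Y + d * (Y * Y)                         ≤⟨ *-cancelˡ-≤ d {{>-nonZero d>0}} scaled ⟩
  s * s * s * d * (N * N)                              ∎)
  where
  open ≤-Reasoning
  s = suc (suc t)
  Y₀ = suc t * (d + N)
  Y = suc Y₀
  N>0 : 0 < N
  N>0 = ≤-trans d>0 (≤-trans (m≤n*m d s) (m≤m+n (s * d) K))
  sN²>0 : 0 < s * (N * N)
  sN²>0 = *-mono-< {0} {s} (s≤s z≤n) (*-mono-< N>0 N>0)
  shift-1 : ∀ a y d → a + (a * y + d * (y * y)) ≡ a * suc y + d * (y * y)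
  shift-1 = solve-∀
  scaled : d * (s * (N * N) * Y + d * (Y * Y)) ≤ d * (s * s * s * d * (N * N))
  scaled = begin
    d * (s * (N * N) * Y + d * (Y * Y))                 ≡⟨ expand-lhs s N d Y ⟩
    s * (N * N) * (d * Y) + (d * Y) * (d * Y)           ≤⟨ +-mono-≤ (*-monoʳ-≤ (s * (N * N)) dY≤s²D) (*-mono-≤ dY≤sW dY≤sW) ⟩
    s * (N * N) * (s * s * D) + (s * W) * (s * W)       ≡⟨ collect s N D W ⟩
    s * s * (N * N * (s * D) + W * W)                   ≤⟨ *-monoʳ-≤ (s * s) N²sD+W²≤N²sd² ⟩
    s * s * (N * N * (s * (d * d)))                     ≡⟨ expand-rhs s N d ⟩
    d * (s * s * s * d * (N * N))                       ∎
    where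
    expand-lhs : ∀ s N d Y → d * (s * (N * N) * Y + d * (Y * Y)) ≡ s * (N * N) * (d * Y) + (d * Y) * (d * Y)
    expand-lhs = solve-∀
    collect : ∀ s N D W → s * (N * N) * (s * s * D) + (s * W) * (s * W) ≡ s * s * (N * N * (s * D) + W * W)
    collect = solve-∀
    expand-rhs : ∀ s N d → s * s * (N * N * (s * (d * d))) ≡ d * (s * s * s * d * (N * N))
    expand-rhs = solve-∀

light-pivot-absurd₁ : ∀ {s} N d D W → s ≡ 1 → 0 < N → 0 < D → N * d ≤ W →
  N * N * (s * D) + W * W ≤ N * N * (s * (d * d)) → ⊥
light-pivot-absurd₁ N d D W refl N>0 D>0 Nd≤W N²sD+W²≤N²sd² = <-irrefl refl (begin-strict
  N * N * (1 * (d * d))                ≡⟨ square N d ⟩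
  (N * d) * (N * d)                    <⟨ m<n+m _ (*-mono-< (*-mono-< N>0 N>0) (subst (0 <_) (sym (*-identityˡ D)) D>0)) ⟩
  N * N * (1 * D) + (N * d) * (N * d)  ≤⟨ +-monoʳ-≤ (N * N * (1 * D)) (*-mono-≤ Nd≤W Nd≤W) ⟩
  N * N * (1 * D) + W * W              ≤⟨ N²sD+W²≤N²sd² ⟩
  N * N * (1 * (d * d))                ∎)
  where
  open ≤-Reasoning
  square : ∀ N d → N * N * (1 * (d * d)) ≡ (N * d) * (N * d)
  square = solve-∀

degree : ∀ {n m} → Edges n m → Fin n → ℕ
degree E x = sum λ i → 𝟙 (x ∈? E i)

module LowerBound {s n m : ℕ} (c : Fin n → Fin (suc s)) (E : Edges n m)
  (partite : Partite c E) (uniform : Uniform (suc s) E) (intersecting : Intersecting E) where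

  only : Fin m → Fin m → Fin n → ℕ
  only j i u = 𝟙 (E j ∩ E i ⊆? ⁅ u ⁆)

  onlyAt : Fin m → Fin n → ℕ
  onlyAt i u = sum λ j → only j i u

  ∩⊆⁅u⁆⇒≡u : ∀ {j i u x} → E j ∩ E i ⊆ ⁅ u ⁆ → x ∈ E j → x ∈ E i → x ≡ u
  ∩⊆⁅u⁆⇒≡u {u = u} sub x∈j x∈i = x∈⁅y⁆⇒x≡y u (sub (x∈p∩q⁺ (x∈j , x∈i)))

  ∩⊆⁅u⁆⇒u∈ : ∀ {j i u} → E j ∩ E i ⊆ ⁅ u ⁆ → u ∈ E j × u ∈ E i
  ∩⊆⁅u⁆⇒u∈ {j} {i} sub with intersecting j i
  ... | x , x∈ with x∈p∩q⁻ (E j) (E i) x∈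
  ...   | x∈j , x∈i with ∩⊆⁅u⁆⇒≡u sub x∈j x∈i
  ...     | refl = x∈j , x∈i

  cover-⊆ : ∀ i u → E i - u ⊆ E i
  cover-⊆ i u = p─q⊆p (E i) ⁅ u ⁆

  cover-multiColored : ∀ i u → MultiColored c (E i - u)
  cover-multiColored i u x y x∈ y∈ = partite i x y (cover-⊆ i u x∈) (cover-⊆ i u y∈)

  ∣cover∣ : ∀ {i u} → u ∈ E i → ∣ E i - u ∣ ≡ s
  ∣cover∣ {i} u∈ = suc-injective (trans (suc∣p-x∣≡∣p∣ u∈) (uniform i))

  -- Every hyperedge meets E i; it misses E i - u exactly when it meets E i in u alone.
  covered+onlyAt≡m : ∀ i u → coveredCount E (E i - u) + onlyAt i u ≡ m
  covered+onlyAt≡m i u = begin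
    coveredCount E (E i - u) + onlyAt i u
      ≡⟨ cong (_+ onlyAt i u) (coveredCount≡sum E (E i - u)) ⟩
    sum (λ j → 𝟙 (nonempty? (E j ∩ (E i - u)))) + onlyAt i u
      ≡⟨ sym (sum-distrib-+ (λ j → 𝟙 (nonempty? (E j ∩ (E i - u)))) (λ j → only j i u)) ⟩
    sum (λ j → 𝟙 (nonempty? (E j ∩ (E i - u))) + only j i u)
      ≡⟨ sum-cong-≗ complementary ⟩
    sum {m} (λ _ → 1)
      ≡⟨ sum-const m 1 ⟩
    m * 1
      ≡⟨ *-identityʳ m ⟩
    m ∎
    where
    open ≡-Reasoning
    missed : ∀ j → E j ∩ E i ⊆ ⁅ u ⁆ → ¬ Nonempty (E j ∩ (E i - u))
    missed j sub (x , x∈) with x∈p∩q⁻ (E j) (E i - u) x∈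
    ... | x∈j , x∈i-u = x∈p-y⇒x≢y x∈i-u (∩⊆⁅u⁆⇒≡u sub x∈j (cover-⊆ i u x∈i-u))
    onlyAt-if-missed : ∀ j → ¬ Nonempty (E j ∩ (E i - u)) → E j ∩ E i ⊆ ⁅ u ⁆
    onlyAt-if-missed j ¬meets {x} x∈ with x∈p∩q⁻ (E j) (E i) x∈ | x ≟ᶠ u
    ... | _         | yes refl = x∈⁅x⁆ u
    ... | x∈j , x∈i | no x≢u   = ⊥-elim (¬meets (x , x∈p∩q⁺ (x∈j , x∈p∧x≢y⇒x∈p-y x∈i x≢u)))
    meets : ∀ j → Dec (Nonempty (E j ∩ (E i - u)))
    meets j = nonempty? (E j ∩ (E i - u))
    complementary : ∀ j → 𝟙 (meets j) + only j i u ≡ 1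
    complementary j = trans (cong (𝟙 (meets j) +_)
                                  (𝟙-cong (E j ∩ E i ⊆? ⁅ u ⁆) (¬? (meets j)) (missed j) (onlyAt-if-missed j)))
                            (𝟙-¬ (meets j))

  colourCount : Fin m → Fin (suc s) → ℕ
  colourCount i k = sum λ x → 𝟙 (x ∈? E i) * 𝟙 (c x ≟ᶠ k)

  -- An edge has at most one vertex of each of the s + 1 colours, and s + 1 vertices.
  colourCount≡1 : ∀ i k → colourCount i k ≡ 1
  colourCount≡1 i = sum≡n⇒all≡1 (colourCount i) at-most-one (begin
    sum (λ k → sum (λ x → 𝟙 (x ∈? E i) * 𝟙 (c x ≟ᶠ k)))
      ≡⟨ sum-swap (λ k x → 𝟙 (x ∈? E i) * 𝟙 (c x ≟ᶠ k)) ⟩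
    sum (λ x → sum (λ k → 𝟙 (x ∈? E i) * 𝟙 (c x ≟ᶠ k)))
      ≡⟨ sum-cong-≗ (λ x → sym (*-distribˡ-sum (𝟙 (x ∈? E i)) (λ k → 𝟙 (c x ≟ᶠ k)))) ⟩
    sum (λ x → 𝟙 (x ∈? E i) * sum (λ k → 𝟙 (c x ≟ᶠ k)))
      ≡⟨ sum-cong-≗ (λ x → cong (𝟙 (x ∈? E i) *_) (one-colour x)) ⟩
    sum (λ x → 𝟙 (x ∈? E i) * 1)
      ≡⟨ sum-cong-≗ (λ x → *-identityʳ (𝟙 (x ∈? E i))) ⟩
    sum (λ x → 𝟙 (x ∈? E i))
      ≡⟨ sym (∣p∣≡sum𝟙∈ (E i)) ⟩
    ∣ E i ∣
      ≡⟨ uniform i ⟩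
    suc s ∎)
    where
    open ≡-Reasoning
    at-most-one : ∀ k → colourCount i k ≤ 1
    at-most-one k = sum-≤1 _ (λ x → 𝟙*𝟙≤1 (x ∈? E i) (c x ≟ᶠ k)) λ x y x>0 y>0 →
      let x∈ , cx≡k = 𝟙*𝟙>0⇒ (x ∈? E i) (c x ≟ᶠ k) x>0
          y∈ , cy≡k = 𝟙*𝟙>0⇒ (y ∈? E i) (c y ≟ᶠ k) y>0
      in partite i x y x∈ y∈ (trans cx≡k (sym cy≡k))
    one-colour : ∀ x → sum (λ k → 𝟙 (c x ≟ᶠ k)) ≡ 1
    one-colour x = trans (sum-cong-≗ (λ k → 𝟙-≟-sym (c x) k)) (sum-𝟙≟ (c x))

  deg : Fin n → ℕ
  deg = degree E

  colour-zero-degrees : sum (λ x → 𝟙 (c x ≟ᶠ zero) * deg x) ≡ m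
  colour-zero-degrees = begin
    sum (λ x → 𝟙 (c x ≟ᶠ zero) * sum (λ i → 𝟙 (x ∈? E i)))
      ≡⟨ sum-cong-≗ (λ x → *-distribˡ-sum (𝟙 (c x ≟ᶠ zero)) (λ i → 𝟙 (x ∈? E i))) ⟩
    sum (λ x → sum (λ i → 𝟙 (c x ≟ᶠ zero) * 𝟙 (x ∈? E i)))
      ≡⟨ sum-swap (λ x i → 𝟙 (c x ≟ᶠ zero) * 𝟙 (x ∈? E i)) ⟩
    sum (λ i → sum (λ x → 𝟙 (c x ≟ᶠ zero) * 𝟙 (x ∈? E i)))
      ≡⟨ sum-cong-≗ (λ i → trans (sum-cong-≗ (λ x → *-comm (𝟙 (c x ≟ᶠ zero)) (𝟙 (x ∈? E i))))
                                 (colourCount≡1 i zero)) ⟩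
    sum {m} (λ _ → 1)
      ≡⟨ trans (sum-const m 1) (*-identityʳ m) ⟩
    m ∎
    where open ≡-Reasoning

  ∃-pivot : 0 < s → 0 < m → ∃ λ v → 0 < deg v × (m ≤ s * deg v ⊎ suc s * deg v ≤ m)
  ∃-pivot s>0 m>0 with ∃-positive-term-outside s m (λ x → 𝟙 (c x ≟ᶠ zero) * deg x) s>0 m>0 colour-zero-degrees
  ... | v , wv>0 , far = v , subst (0 <_) w≡deg wv>0 , subst (λ z → m ≤ s * z ⊎ suc s * z ≤ m) w≡deg far
    where
    w≡deg : 𝟙 (c v ≟ᶠ zero) * deg v ≡ deg v
    w≡deg = 𝟙*-identity (c v ≟ᶠ zero) (λ _ → proj₁ (𝟙*>0⇒ (c v ≟ᶠ zero) wv>0))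

  Y : ℕ
  Y = suc ((s ∸ 1) * m)

  Poor : Set
  Poor = ∀ i u → u ∈ E i → Y ≤ onlyAt i u * (s * s)

  module AroundVertex (v : Fin n) where

    through avoids : Fin m → ℕ
    through i = 𝟙 (v ∈? E i)
    avoids i = 𝟙 (¬? (v ∈? E i))

    d N : ℕ
    d = sum through
    N = sum avoids

    d+N≡m : d + N ≡ m
    d+N≡m = begin
      d + N                              ≡⟨ sym (sum-distrib-+ through avoids) ⟩
      sum (λ i → through i + avoids i)   ≡⟨ sum-cong-≗ (λ i → 𝟙-¬ (v ∈? E i)) ⟩
      sum {m} (λ _ → 1)                  ≡⟨ trans (sum-const m 1) (*-identityʳ m) ⟩
      m                                  ∎
      where open ≡-Reasoning

    rest : Fin m → Fin n → ℕ
    rest i u = 𝟙 (u ∈? E i - v)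

    sum-rest : ∀ {i} → v ∈ E i → sum (rest i) ≡ s
    sum-rest {i} v∈ = trans (sym (∣p∣≡sum𝟙∈ (E i - v))) (∣cover∣ v∈)

    inner : Fin m → Fin m → ℕ
    inner j i = sum λ u → rest i u * only j i u

    t : Fin m → ℕ
    t j = sum λ i → through i * inner j i

    W D : ℕ
    W = sum λ i → through i * sum (λ u → rest i u * onlyAt i u)
    D = sum λ i → through i * onlyAt i v

    W≡sum-t : W ≡ sum t
    W≡sum-t = begin
      sum (λ i → through i * sum (λ u → rest i u * sum (λ j → only j i u)))
        ≡⟨ sum-cong-≗ (λ i → cong (through i *_) (sum-cong-≗ (λ u → *-distribˡ-sum (rest i u) (λ j → only j i u)))) ⟩
      sum (λ i → through i * sum (λ u → sum (λ j → rest i u * only j i u)))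
        ≡⟨ sum-cong-≗ (λ i → cong (through i *_) (sum-swap (λ u j → rest i u * only j i u))) ⟩
      sum (λ i → through i * sum (λ j → inner j i))
        ≡⟨ sum-cong-≗ (λ i → *-distribˡ-sum (through i) (λ j → inner j i)) ⟩
      sum (λ i → sum (λ j → through i * inner j i))
        ≡⟨ sum-swap (λ i j → through i * inner j i) ⟩
      sum t ∎
      where open ≡-Reasoning

    rest*only>0⇒ : ∀ {j i u} → 0 < rest i u * only j i u → u ∈ E i - v × E j ∩ E i ⊆ ⁅ u ⁆
    rest*only>0⇒ {j} {i} {u} = 𝟙*𝟙>0⇒ (u ∈? E i - v) (E j ∩ E i ⊆? ⁅ u ⁆)

    inner≤1 : ∀ j i → inner j i ≤ 1
    inner≤1 j i = sum-≤1 _ (λ u → 𝟙*𝟙≤1 (u ∈? E i - v) (E j ∩ E i ⊆? ⁅ u ⁆)) λ u u′ u>0 u′>0 →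
      let u∈j , u∈i = ∩⊆⁅u⁆⇒u∈ (proj₂ (rest*only>0⇒ u>0))
      in ∩⊆⁅u⁆⇒≡u (proj₂ (rest*only>0⇒ u′>0)) u∈j u∈i

    term>0⇒ : ∀ {j i} → 0 < through i * inner j i → v ∈ E i × ∃ λ u → u ∈ E i - v × E j ∩ E i ⊆ ⁅ u ⁆
    term>0⇒ {j} {i} pos with 𝟙*>0⇒ (v ∈? E i) pos
    ... | v∈i , inner>0 with sum>0⇒∃ (λ u → rest i u * only j i u) inner>0
    ...   | u , u>0 = v∈i , u , rest*only>0⇒ u>0

    t≤d : ∀ j → t j ≤ d
    t≤d j = sum-mono-≤ (λ i → ≤-trans (*-monoʳ-≤ (through i) (inner≤1 j i)) (≤-reflexive (*-identityʳ (through i))))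

    t≡0 : ∀ {j} → v ∈ E j → t j ≡ 0
    t≡0 {j} v∈j = sum≡0 {m} λ i pos →
      let v∈i , u , u∈ , sub = term>0⇒ {j} {i} pos
      in x∈p-y⇒x≢y u∈ (sym (∩⊆⁅u⁆⇒≡u sub v∈j v∈i))

    t≡avoids*t : ∀ j → t j ≡ avoids j * t j
    t≡avoids*t j = sym (𝟙*-identity (¬? (v ∈? E j)) (λ t>0 v∈j → <-irrefl (sym (t≡0 v∈j)) t>0))

    W≡sum-avoids*t : W ≡ sum (λ j → avoids j * t j)
    W≡sum-avoids*t = trans W≡sum-t (sum-cong-≗ t≡avoids*t)

    W≤N*d : W ≤ N * d
    W≤N*d = begin
      W                              ≡⟨ W≡sum-avoids*t ⟩
      sum (λ j → avoids j * t j)     ≤⟨ sum-mono-≤ (λ j → *-monoʳ-≤ (avoids j) (t≤d j)) ⟩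
      sum (λ j → avoids j * d)       ≡⟨ sym (*-distribʳ-sum d avoids) ⟩
      N * d                          ∎
      where open ≤-Reasoning

    -- when s = 1, a hyperedge E i through v meets any E j avoiding v in exactly one vertex
    inner≥1 : s ≡ 1 → ∀ {j i} → v ∉ E j → v ∈ E i → 1 ≤ inner j i
    inner≥1 s≡1 {j} {i} v∉j v∈i with intersecting i j
    ... | x , x∈ with x∈p∩q⁻ (E i) (E j) x∈
    ...   | x∈i , x∈j = ≤-trans (≤-reflexive (sym one)) (f≤sum (λ u → rest i u * only j i u) x)
      where
      x∈i-v : x ∈ E i - v
      x∈i-v = x∈p∧x≢y⇒x∈p-y x∈i (λ { refl → v∉j x∈j })
      sub : E j ∩ E i ⊆ ⁅ x ⁆
      sub {y} y∈ with x∈p∩q⁻ (E j) (E i) y∈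
      ... | y∈j , y∈i = subst (_∈ ⁅ x ⁆)
                          (∣p∣≡1⇒x≡y (trans (∣cover∣ v∈i) s≡1) x∈i-v
                                     (x∈p∧x≢y⇒x∈p-y y∈i (λ { refl → v∉j y∈j })))
                          (x∈⁅x⁆ x)
      one : rest i x * only j i x ≡ 1
      one = cong₂ _*_ (𝟙-yes (x ∈? E i - v) x∈i-v) (𝟙-yes (E j ∩ E i ⊆? ⁅ x ⁆) sub)

    N*d≤W : s ≡ 1 → N * d ≤ W
    N*d≤W s≡1 = begin
      N * d                          ≡⟨ *-distribʳ-sum d avoids ⟩
      sum (λ j → avoids j * d)       ≤⟨ sum-mono-≤ (λ j → 𝟙*-monoʳ-≤ (¬? (v ∈? E j)) (d≤t j)) ⟩
      sum (λ j → avoids j * t j)     ≡⟨ sym W≡sum-avoids*t ⟩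
      W                              ∎
      where
      open ≤-Reasoning
      d≤t : ∀ j → v ∉ E j → d ≤ t j
      d≤t j v∉j = sum-mono-≤ (λ i → subst (_≤ through i * inner j i) (*-identityʳ (through i))
                    (𝟙*-monoʳ-≤ (v ∈? E i) (inner≥1 s≡1 v∉j)))

    module Avoiding (j : Fin m) (v∉j : v ∉ E j) where

      g : Fin m → Fin n → ℕ
      g i w = through i * (rest i w * only j i w)

      load : Fin n → ℕ
      load w = sum λ i → g i w

      g>0⇒ : ∀ {i w} → 0 < g i w → v ∈ E i × w ∈ E i - v × E j ∩ E i ⊆ ⁅ w ⁆
      g>0⇒ {i} {w} pos with 𝟙*>0⇒ (v ∈? E i) pos
      ... | v∈i , rest*only>0 = v∈i , rest*only>0⇒ rest*only>0

      g≤1 : ∀ i w → g i w ≤ 1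
      g≤1 i w = ≤-trans (𝟙*≤ (v ∈? E i) _) (𝟙*𝟙≤1 (w ∈? E i - v) (E j ∩ E i ⊆? ⁅ w ⁆))

      sum-load : sum load ≡ t j
      sum-load = begin
        sum (λ w → sum (λ i → g i w))   ≡⟨ sum-swap (λ w i → g i w) ⟩
        sum (λ i → sum (λ w → g i w))   ≡⟨ sum-cong-≗ (λ i → sym (*-distribˡ-sum (through i) (λ w → rest i w * only j i w))) ⟩
        t j                             ∎
        where open ≡-Reasoning

      -- pairs (i, k) of edges through v: either E k ∩ E i = {v} (counted by D), or they share
      -- at most one vertex w ≠ v with E j ∩ E i = E j ∩ E k = {w}
      pair-bound : ∀ i k → through i * only k i v + sum (λ w → g i w * g k w) ≤ through i * through k
      pair-bound i k = ≤1∧>0⇒≤ ≤1 >0⇒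
        where
        sum-g≤1 : sum (λ w → g i w) ≤ 1
        sum-g≤1 = begin
          sum (λ w → through i * (rest i w * only j i w)) ≡⟨ sym (*-distribˡ-sum (through i) (λ w → rest i w * only j i w)) ⟩
          through i * inner j i                          ≤⟨ 𝟙*≤ (v ∈? E i) (inner j i) ⟩
          inner j i                                      ≤⟨ inner≤1 j i ⟩
          1                                              ∎
          where open ≤-Reasoning
        shared≡0 : E k ∩ E i ⊆ ⁅ v ⁆ → sum (λ w → g i w * g k w) ≡ 0
        shared≡0 sub = sum≡0 {n} λ w pos →
          let gi>0 , gk>0 = *>0⇒ (g i w) (g k w) pos
              _ , w∈i-v , _ = g>0⇒ {i} {w} gi>0
              _ , w∈k-v , _ = g>0⇒ {k} {w} gk>0
          in x∈p-y⇒x≢y w∈i-v (∩⊆⁅u⁆⇒≡u sub (cover-⊆ k v w∈k-v) (cover-⊆ i v w∈i-v))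
        shared≤1 : sum (λ w → g i w * g k w) ≤ 1
        shared≤1 = ≤-trans (sum-mono-≤ (λ w → ≤-trans (*-monoʳ-≤ (g i w) (g≤1 k w)) (≤-reflexive (*-identityʳ (g i w)))))
                           sum-g≤1
        ≤1 : through i * only k i v + sum (λ w → g i w * g k w) ≤ 1
        ≤1 = 𝟙-elim (E k ∩ E i ⊆? ⁅ v ⁆) (λ b → through i * b + sum (λ w → g i w * g k w) ≤ 1)
          (λ sub → subst (λ z → through i * 1 + z ≤ 1) (sym (shared≡0 sub))
                     (≤-trans (≤-reflexive (trans (+-identityʳ (through i * 1)) (*-identityʳ (through i)))) (𝟙≤1 (v ∈? E i))))
          (λ _ → subst (λ z → z + sum (λ w → g i w * g k w) ≤ 1) (sym (*-zeroʳ (through i))) shared≤1)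
        both : v ∈ E i → v ∈ E k → 0 < through i * through k
        both v∈i v∈k = subst (0 <_) (sym (cong₂ _*_ (𝟙-yes (v ∈? E i) v∈i) (𝟙-yes (v ∈? E k) v∈k))) (s≤s z≤n)
        >0⇒ : 0 < through i * only k i v + sum (λ w → g i w * g k w) → 0 < through i * through k
        >0⇒ pos with +>0⇒ pos
        ... | inj₁ first>0 = let v∈i , sub = 𝟙*𝟙>0⇒ (v ∈? E i) (E k ∩ E i ⊆? ⁅ v ⁆) first>0
                             in both v∈i (proj₁ (∩⊆⁅u⁆⇒u∈ sub))
        ... | inj₂ second>0 with sum>0⇒∃ (λ w → g i w * g k w) second>0
        ...   | w , gg>0 = let gi>0 , gk>0 = *>0⇒ (g i w) (g k w) gg>0
                           in both (proj₁ (g>0⇒ {i} {w} gi>0)) (proj₁ (g>0⇒ {k} {w} gk>0))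

      D+∑load²≤d² : D + sum (λ w → load w * load w) ≤ d * d
      D+∑load²≤d² = begin
        D + sum (λ w → load w * load w)
          ≡⟨ cong₂ _+_ D≡ ∑load²≡ ⟩
        sum (λ i → sum (λ k → through i * only k i v)) + sum (λ i → sum (λ k → sum (λ w → g i w * g k w)))
          ≡⟨ sum-distrib-+ (λ i → sum (λ k → through i * only k i v)) (λ i → sum (λ k → sum (λ w → g i w * g k w))) ⟨
        sum (λ i → sum (λ k → through i * only k i v) + sum (λ k → sum (λ w → g i w * g k w)))
          ≡⟨ sum-cong-≗ (λ i → sym (sum-distrib-+ (λ k → through i * only k i v) (λ k → sum (λ w → g i w * g k w)))) ⟩
        sum (λ i → sum (λ k → through i * only k i v + sum (λ w → g i w * g k w)))
          ≤⟨ sum-mono-≤ (λ i → sum-mono-≤ (pair-bound i)) ⟩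
        sum (λ i → sum (λ k → through i * through k))
          ≡⟨ sym (sum-*-sum through through) ⟩
        d * d ∎
        where
        open ≤-Reasoning
        D≡ : D ≡ sum (λ i → sum (λ k → through i * only k i v))
        D≡ = sum-cong-≗ (λ i → *-distribˡ-sum (through i) (λ k → only k i v))
        ∑load²≡ : sum (λ w → load w * load w) ≡ sum (λ i → sum (λ k → sum (λ w → g i w * g k w)))
        ∑load²≡ = begin-equality
          sum (λ w → load w * load w)                           ≡⟨ sum-cong-≗ (λ w → sum-*-sum (λ i → g i w) (λ k → g k w)) ⟩
          sum (λ w → sum (λ i → sum (λ k → g i w * g k w)))     ≡⟨ sum-swap (λ w i → sum (λ k → g i w * g k w)) ⟩
          sum (λ i → sum (λ w → sum (λ k → g i w * g k w)))     ≡⟨ sum-cong-≗ (λ i → sum-swap (λ w k → g i w * g k w)) ⟩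
          sum (λ i → sum (λ k → sum (λ w → g i w * g k w)))     ∎

      colourful : Fin n → ℕ
      colourful w = 𝟙 ((w ∈? E j) ×-dec ¬? (c w ≟ᶠ c v))

      -- every w with load w > 0 lies in E j and has a colour other than that of v
      colourful*load≡load : ∀ w → colourful w * load w ≡ load w
      colourful*load≡load w = 𝟙*-identity ((w ∈? E j) ×-dec ¬? (c w ≟ᶠ c v)) λ load>0 →
        let i , gi>0 = sum>0⇒∃ (λ i → g i w) load>0
            v∈i , w∈i-v , sub = g>0⇒ gi>0
        in proj₁ (∩⊆⁅u⁆⇒u∈ sub) ,
           λ cw≡cv → x∈p-y⇒x≢y w∈i-v (partite i w v (cover-⊆ i v w∈i-v) v∈i cw≡cv)

      sum-colourful : sum colourful ≡ s
      sum-colourful = suc-injective (begin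
        suc (sum colourful)
          ≡⟨ cong (_+ sum colourful) (sym (colourCount≡1 j (c v))) ⟩
        colourCount j (c v) + sum colourful
          ≡⟨ sym (sum-distrib-+ (λ w → 𝟙 (w ∈? E j) * 𝟙 (c w ≟ᶠ c v)) colourful) ⟩
        sum (λ w → 𝟙 (w ∈? E j) * 𝟙 (c w ≟ᶠ c v) + colourful w)
          ≡⟨ sum-cong-≗ split ⟩
        sum (λ w → 𝟙 (w ∈? E j))
          ≡⟨ sym (∣p∣≡sum𝟙∈ (E j)) ⟩
        ∣ E j ∣
          ≡⟨ uniform j ⟩
        suc s ∎)
        where
        open ≡-Reasoning
        split : ∀ w → 𝟙 (w ∈? E j) * 𝟙 (c w ≟ᶠ c v) + colourful w ≡ 𝟙 (w ∈? E j)
        split w = begin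
          𝟙 (w ∈? E j) * 𝟙 (c w ≟ᶠ c v) + colourful w
            ≡⟨ cong (𝟙 (w ∈? E j) * 𝟙 (c w ≟ᶠ c v) +_) (𝟙-× (w ∈? E j) (¬? (c w ≟ᶠ c v))) ⟩
          𝟙 (w ∈? E j) * 𝟙 (c w ≟ᶠ c v) + 𝟙 (w ∈? E j) * 𝟙 (¬? (c w ≟ᶠ c v))
            ≡⟨ sym (*-distribˡ-+ (𝟙 (w ∈? E j)) _ _) ⟩
          𝟙 (w ∈? E j) * (𝟙 (c w ≟ᶠ c v) + 𝟙 (¬? (c w ≟ᶠ c v)))
            ≡⟨ cong (𝟙 (w ∈? E j) *_) (𝟙-¬ (c w ≟ᶠ c v)) ⟩
          𝟙 (w ∈? E j) * 1
            ≡⟨ *-identityʳ (𝟙 (w ∈? E j)) ⟩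
          𝟙 (w ∈? E j) ∎

      sD+t²≤sd² : s * D + t j * t j ≤ s * (d * d)
      sD+t²≤sd² = begin
        s * D + t j * t j
          ≡⟨ cong (λ z → s * D + z * z) (trans (sym sum-load) (sum-cong-≗ (λ w → sym (colourful*load≡load w)))) ⟩
        s * D + sum (λ w → colourful w * load w) * sum (λ w → colourful w * load w)
          ≤⟨ +-monoʳ-≤ (s * D) (cauchy-schwarz colourful load) ⟩
        s * D + sum colourful * sum (λ w → colourful w * (load w * load w))
          ≤⟨ +-monoʳ-≤ (s * D) (*-mono-≤ (≤-reflexive sum-colourful)
                                          (sum-mono-≤ (λ w → 𝟙*≤ ((w ∈? E j) ×-dec ¬? (c w ≟ᶠ c v)) (load w * load w)))) ⟩
        s * D + s * sum (λ w → load w * load w)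
          ≡⟨ sym (*-distribˡ-+ s D _) ⟩
        s * (D + sum (λ w → load w * load w))
          ≤⟨ *-monoʳ-≤ s D+∑load²≤d² ⟩
        s * (d * d) ∎
        where open ≤-Reasoning

    N²sD+W²≤N²sd² : N * N * (s * D) + W * W ≤ N * N * (s * (d * d))
    N²sD+W²≤N²sd² = begin
      N * N * (s * D) + W * W
        ≡⟨ cong (λ z → N * N * (s * D) + z * z) W≡sum-avoids*t ⟩
      N * N * (s * D) + sum (λ j → avoids j * t j) * sum (λ j → avoids j * t j)
        ≤⟨ +-monoʳ-≤ (N * N * (s * D)) (cauchy-schwarz avoids t) ⟩
      N * N * (s * D) + N * sum (λ j → avoids j * (t j * t j))
        ≡⟨ cong (λ z → z + N * sum (λ j → avoids j * (t j * t j))) (*-assoc N N (s * D)) ⟩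
      N * (N * (s * D)) + N * sum (λ j → avoids j * (t j * t j))
        ≡⟨ cong (λ z → N * z + N * sum (λ j → avoids j * (t j * t j))) (*-distribʳ-sum (s * D) avoids) ⟩
      N * sum (λ j → avoids j * (s * D)) + N * sum (λ j → avoids j * (t j * t j))
        ≡⟨ sym (*-distribˡ-+ N _ _) ⟩
      N * (sum (λ j → avoids j * (s * D)) + sum (λ j → avoids j * (t j * t j)))
        ≡⟨ cong (N *_) (sym (sum-distrib-+ (λ j → avoids j * (s * D)) (λ j → avoids j * (t j * t j)))) ⟩
      N * sum (λ j → avoids j * (s * D) + avoids j * (t j * t j))
        ≡⟨ cong (N *_) (sum-cong-≗ (λ j → sym (*-distribˡ-+ (avoids j) (s * D) (t j * t j)))) ⟩
      N * sum (λ j → avoids j * (s * D + t j * t j))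
        ≤⟨ *-monoʳ-≤ N (sum-mono-≤ (λ j → 𝟙*-monoʳ-≤ (¬? (v ∈? E j)) (Avoiding.sD+t²≤sd² j))) ⟩
      N * sum (λ j → avoids j * (s * (d * d)))
        ≡⟨ cong (N *_) (sym (*-distribʳ-sum (s * (d * d)) avoids)) ⟩
      N * (N * (s * (d * d)))
        ≡⟨ sym (*-assoc N N _) ⟩
      N * N * (s * (d * d)) ∎
      where open ≤-Reasoning

    module _ (poor : Poor) where

      dY≤s²D : d * Y ≤ s * s * D
      dY≤s²D = begin
        d * Y                                           ≡⟨ *-distribʳ-sum Y through ⟩
        sum (λ i → through i * Y)                       ≤⟨ sum-mono-≤ (λ i → 𝟙*-monoʳ-≤ (v ∈? E i) (poor i v)) ⟩
        sum (λ i → through i * (onlyAt i v * (s * s)))  ≡⟨ sum-cong-≗ (λ i → rearrange (through i) (onlyAt i v) (s * s)) ⟩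
        sum (λ i → s * s * (through i * onlyAt i v))    ≡⟨ sym (*-distribˡ-sum (s * s) (λ i → through i * onlyAt i v)) ⟩
        s * s * D                                       ∎
        where
        open ≤-Reasoning
        rearrange : ∀ x y z → x * (y * z) ≡ z * (x * y)
        rearrange = solve-∀

      dY≤sW : 0 < s → d * Y ≤ s * W
      dY≤sW s>0 = *-cancelˡ-≤ s {{>-nonZero s>0}} (begin
        s * (d * Y)
          ≡⟨ cong (s *_) (*-distribʳ-sum Y through) ⟩
        s * sum (λ i → through i * Y)
          ≡⟨ *-distribˡ-sum s (λ i → through i * Y) ⟩
        sum (λ i → s * (through i * Y))
          ≡⟨ sum-cong-≗ (λ i → swap-front s (through i) Y) ⟩
        sum (λ i → through i * (s * Y))
          ≤⟨ sum-mono-≤ (λ i → 𝟙*-monoʳ-≤ (v ∈? E i) (around-edge i)) ⟩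
        sum (λ i → through i * (s * s * sum (λ u → rest i u * onlyAt i u)))
          ≡⟨ sum-cong-≗ (λ i → swap-front (through i) (s * s) _) ⟩
        sum (λ i → s * s * (through i * sum (λ u → rest i u * onlyAt i u)))
          ≡⟨ sym (*-distribˡ-sum (s * s) (λ i → through i * sum (λ u → rest i u * onlyAt i u))) ⟩
        s * s * W
          ≡⟨ *-assoc s s W ⟩
        s * (s * W) ∎)
        where
        open ≤-Reasoning
        swap-front : ∀ x y z → x * (y * z) ≡ y * (x * z)
        swap-front = solve-∀
        around-edge : ∀ i → v ∈ E i → s * Y ≤ s * s * sum (λ u → rest i u * onlyAt i u)
        around-edge i v∈ = begin
          s * Y                                          ≡⟨ cong (_* Y) (sym (sum-rest v∈)) ⟩
          sum (rest i) * Y                               ≡⟨ *-distribʳ-sum Y (rest i) ⟩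
          sum (λ u → rest i u * Y)
            ≤⟨ sum-mono-≤ (λ u → 𝟙*-monoʳ-≤ (u ∈? E i - v) (λ u∈ → poor i u (cover-⊆ i v u∈))) ⟩
          sum (λ u → rest i u * (onlyAt i u * (s * s)))  ≡⟨ sum-cong-≗ (λ u → cong (rest i u *_) (*-comm (onlyAt i u) (s * s))) ⟩
          sum (λ u → rest i u * (s * s * onlyAt i u))    ≡⟨ sum-cong-≗ (λ u → swap-front (rest i u) (s * s) (onlyAt i u)) ⟩
          sum (λ u → s * s * (rest i u * onlyAt i u))    ≡⟨ sym (*-distribˡ-sum (s * s) (λ u → rest i u * onlyAt i u)) ⟩
          s * s * sum (λ u → rest i u * onlyAt i u)      ∎

      m≰s*d : 0 < s → 0 < d → ¬ m ≤ s * d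
      m≰s*d s>0 d>0 m≤sd = <-irrefl refl (begin-strict
        s * m                 ≡⟨ s*m≡m+[s∸1]*m s m s>0 ⟩
        m + (s ∸ 1) * m       <⟨ +-monoʳ-< m (n<1+n _) ⟩
        m + Y                 ≤⟨ +-mono-≤ m≤sd Y≤sN ⟩
        s * d + s * N         ≡⟨ sym (*-distribˡ-+ s d N) ⟩
        s * (d + N)           ≡⟨ cong (s *_) d+N≡m ⟩
        s * m                 ∎)
        where
        open ≤-Reasoning
        Y≤sN : Y ≤ s * N
        Y≤sN = *-cancelˡ-≤ d {{>-nonZero d>0}} (begin
          d * Y          ≤⟨ dY≤sW s>0 ⟩
          s * W          ≤⟨ *-monoʳ-≤ s W≤N*d ⟩
          s * (N * d)    ≡⟨ rearrange s N d ⟩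
          d * (s * N)    ∎)
          where
          rearrange : ∀ s N d → s * (N * d) ≡ d * (s * N)
          rearrange = solve-∀

      [1+s]*d≰m : 0 < s → 0 < d → ¬ suc s * d ≤ m
      [1+s]*d≰m s>0 d>0 [s+1]d≤m = by-cases (s ≟ 1)
        where
        sd≤N : s * d ≤ N
        sd≤N = +-cancelˡ-≤ d (s * d) N (≤-trans [s+1]d≤m (≤-reflexive (sym d+N≡m)))
        N>0 : 0 < N
        N>0 = ≤-trans d>0 (≤-trans (m≤n*m d s {{>-nonZero s>0}}) sd≤N)
        D>0 : 0 < D
        D>0 = proj₂ (*>0⇒ (s * s) D (≤-trans (*-mono-≤ d>0 (s≤s z≤n)) dY≤s²D))
        by-cases : Dec (s ≡ 1) → ⊥
        by-cases (yes s≡1) = light-pivot-absurd₁ N d D W s≡1 N>0 D>0 (N*d≤W s≡1) N²sD+W²≤N²sd²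
        by-cases (no  s≢1) = light-pivot-absurd d N D W (≤∧≢⇒< s>0 (s≢1 ∘ sym)) d>0 d+N≡m sd≤N
                               dY≤s²D (dY≤sW s>0) N²sD+W²≤N²sd²

  Good : Fin m → Fin n → Set
  Good i u = u ∈ E i × onlyAt i u * (s * s) ≤ (s ∸ 1) * m

  ∃-good : 0 < s → 0 < m → ∃₂ Good
  ∃-good s>0 m>0 with any? (λ i → any? (λ u → (u ∈? E i) ×-dec (onlyAt i u * (s * s) ≤? (s ∸ 1) * m)))
  ... | yes (i , u , good) = i , u , good
  ... | no ∄good = ⊥-elim (refute (∃-pivot s>0 m>0))
    where
    poor : Poor
    poor i u u∈ = ≰⇒> (λ good → ∄good (i , u , u∈ , good))
    refute : ∃ (λ v → 0 < deg v × (m ≤ s * deg v ⊎ suc s * deg v ≤ m)) → ⊥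
    refute (v , d>0 , inj₁ m≤sd)     = AroundVertex.m≰s*d v poor s>0 d>0 m≤sd
    refute (v , d>0 , inj₂ [s+1]d≤m) = AroundVertex.[1+s]*d≰m v poor s>0 d>0 [s+1]d≤m

∃-multiColored : ∀ {s n} (c : Fin n → Fin (suc s)) → Surjective c →
  ∃ λ (T : Subset n) → MultiColored c T × ∣ T ∣ ≡ s
∃-multiColored {s} {n} c surj =
  T₀ - rep zero , multiColored , suc-injective (trans (suc∣p-x∣≡∣p∣ (rep∈T₀ zero)) ∣T₀∣)
  where
  rep : Fin (suc s) → Fin n
  rep k = proj₁ (surj k)
  T₀ : Subset n
  T₀ = subset (λ x → x ≟ᶠ rep (c x))
  rep∈T₀ : ∀ k → rep k ∈ T₀
  rep∈T₀ k = ∈-subset⁺ (λ x → x ≟ᶠ rep (c x)) (cong rep (sym (proj₂ (surj k))))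
  multiColored : MultiColored c (T₀ - rep zero)
  multiColored x y x∈ y∈ cx≡cy = begin
    x            ≡⟨ ∈-subset⁻ (λ x → x ≟ᶠ rep (c x)) (p─q⊆p T₀ ⁅ rep zero ⁆ x∈) ⟩
    rep (c x)    ≡⟨ cong rep cx≡cy ⟩
    rep (c y)    ≡⟨ ∈-subset⁻ (λ x → x ≟ᶠ rep (c x)) (p─q⊆p T₀ ⁅ rep zero ⁆ y∈) ⟨
    y            ∎
    where open ≡-Reasoning
  ∣T₀∣ : ∣ T₀ ∣ ≡ suc s
  ∣T₀∣ = begin
    ∣ T₀ ∣
      ≡⟨ ∣subset∣ (λ x → x ≟ᶠ rep (c x)) ⟩
    sum (λ x → 𝟙 (x ≟ᶠ rep (c x)))
      ≡⟨ sum-cong-≗ (λ x → sym (sum-δ (c x) (λ k → 𝟙 (x ≟ᶠ rep k)))) ⟩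
    sum (λ x → sum (λ k → 𝟙 (k ≟ᶠ c x) * 𝟙 (x ≟ᶠ rep k)))
      ≡⟨ sum-swap (λ x k → 𝟙 (k ≟ᶠ c x) * 𝟙 (x ≟ᶠ rep k)) ⟩
    sum (λ k → sum (λ x → 𝟙 (k ≟ᶠ c x) * 𝟙 (x ≟ᶠ rep k)))
      ≡⟨ sum-cong-≗ (λ k → trans (sum-cong-≗ (λ x → *-comm (𝟙 (k ≟ᶠ c x)) (𝟙 (x ≟ᶠ rep k))))
                                 (sum-δ (rep k) (λ x → 𝟙 (k ≟ᶠ c x)))) ⟩
    sum (λ k → 𝟙 (k ≟ᶠ c (rep k)))
      ≡⟨ sum-cong-≗ (λ k → 𝟙-yes (k ≟ᶠ c (rep k)) (sym (proj₂ (surj k)))) ⟩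
    sum {suc s} (λ _ → 1)
      ≡⟨ trans (sum-const (suc s) 1) (*-identityʳ (suc s)) ⟩
    suc s ∎
    where open ≡-Reasoning

AtLeastBound-from-uncovered : ∀ s m k a → k + a ≡ m → a * (suc s * suc s) ≤ s * m →
  AtLeastBound (suc (suc s)) m k
AtLeastBound-from-uncovered s m k a k+a≡m a[s+1]²≤sm = +-cancelʳ-≤ (s * m) _ _ (begin
  (S ∸ s) * m + s * m     ≡⟨ sym (*-distribʳ-+ m (S ∸ s) s) ⟩
  (S ∸ s + s) * m         ≡⟨ cong (_* m) (m∸n+n≡m s≤S) ⟩
  S * m                   ≡⟨ cong (S *_) (sym k+a≡m) ⟩
  S * (k + a)             ≡⟨ *-distribˡ-+ S k a ⟩
  S * k + S * a           ≡⟨ cong₂ _+_ (*-comm S k) (trans (*-comm S a) (cong (a *_) S≡)) ⟩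
  k * S + a * (suc s * suc s) ≤⟨ +-monoʳ-≤ (k * S) a[s+1]²≤sm ⟩
  k * S + s * m           ∎)
  where
  open ≤-Reasoning
  S = suc s ^ 2
  S≡ : S ≡ suc s * suc s
  S≡ = cong (suc s *_) (*-identityʳ (suc s))
  s≤S : s ≤ S
  s≤S = ≤-trans (n≤1+n s) (≤-trans (m≤m*n (suc s) (suc s)) (≤-reflexive (sym S≡)))

lower-bound : ∀ (r n m : ℕ) → r ≥ 2 → (c : Fin n → Fin r) → (E : Edges n m) →
  IsRPartiteRUniformIntersecting r c E →
    (∃ λ (T : Subset n) → MultiColored c T × ∣ T ∣ ≡ r ∸ 1
                          × AtLeastBound r m (coveredCount E T))
    × (Fin m → ∃ λ (T : Subset n) → ∃ λ (i : Fin m) → T ⊆ E i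
                          × MultiColored c T × ∣ T ∣ ≡ r ∸ 1
                          × AtLeastBound r m (coveredCount E T))
lower-bound (suc (suc s)) n m (s≤s (s≤s z≤n)) c E (surj , partite , uniform , intersecting) =
  anyCover (m ≟ 0) , inEdge
  where
  open LowerBound c E partite uniform intersecting
  inEdge : Fin m → ∃ λ (T : Subset n) → ∃ λ (i : Fin m) → T ⊆ E i × MultiColored c T × ∣ T ∣ ≡ suc s
                     × AtLeastBound (suc (suc s)) m (coveredCount E T)
  inEdge i₀ with ∃-good (s≤s z≤n) (>-nonZero⁻¹ m {{nonZeroIndex i₀}})
  ... | i , u , u∈ , bound = E i - u , i , cover-⊆ i u , cover-multiColored i u , ∣cover∣ u∈ ,
        AtLeastBound-from-uncovered s m _ (onlyAt i u) (covered+onlyAt≡m i u) bound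
  anyCover : Dec (m ≡ 0) → ∃ λ (T : Subset n) → MultiColored c T × ∣ T ∣ ≡ suc s
                             × AtLeastBound (suc (suc s)) m (coveredCount E T)
  anyCover (yes m≡0) = let T , multiColored , ∣T∣ = ∃-multiColored c surj in
    T , multiColored , ∣T∣ ,
    subst (_≤ coveredCount E T * suc s ^ 2) (sym (trans (cong ((suc s ^ 2 ∸ s) *_) m≡0) (*-zeroʳ (suc s ^ 2 ∸ s)))) z≤n
  anyCover (no m≢0)  = let T , _ , _ , rest = inEdge (fromℕ< (n≢0⇒n>0 m≢0)) in T , rest

-- Sharpness

module _ {n m r p : ℕ} (c : Fin n → Fin r) (E : Edges n m)
  (degree≤p : ∀ v → degree E v ≤ p) (joined : ∀ v w → c v ≢ c w → ∃ λ e → v ∈ E e × w ∈ E e) where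

  -- A hyperedge covered by T either contains the chosen v₀ ∈ T, or avoids v₀ and contains a
  -- vertex x of T - v₀; such an x lies in at most p - 1 hyperedges avoiding v₀, since one of
  -- its at most p hyperedges also contains v₀.
  coveredCount≤ : ∀ T → MultiColored c T → ∣ T ∣ ≡ p → 0 < p → coveredCount E T ≤ p + (p ∸ 1) * (p ∸ 1)
  coveredCount≤ T multiColored ∣T∣≡p p>0
    with sum>0⇒∃ (λ x → 𝟙 (x ∈? T)) (subst (0 <_) (trans (sym ∣T∣≡p) (∣p∣≡sum𝟙∈ T)) p>0)
  ... | v₀ , v₀>0 = begin
    coveredCount E T
      ≡⟨ coveredCount≡sum E T ⟩
    sum (λ e → 𝟙 (nonempty? (E e ∩ T)))
      ≤⟨ sum-mono-≤ covered≤ ⟩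
    sum (λ e → 𝟙 (v₀ ∈? E e) + sum (λ x → 𝟙 (x ∈? T′) * missing e x))
      ≡⟨ sum-distrib-+ (λ e → 𝟙 (v₀ ∈? E e)) (λ e → sum (λ x → 𝟙 (x ∈? T′) * missing e x)) ⟩
    degree E v₀ + sum (λ e → sum (λ x → 𝟙 (x ∈? T′) * missing e x))
      ≡⟨ cong (degree E v₀ +_) (sum-swap (λ e x → 𝟙 (x ∈? T′) * missing e x)) ⟩
    degree E v₀ + sum (λ x → sum (λ e → 𝟙 (x ∈? T′) * missing e x))
      ≡⟨ cong (degree E v₀ +_) (sum-cong-≗ (λ x → sym (*-distribˡ-sum (𝟙 (x ∈? T′)) (λ e → missing e x)))) ⟩
    degree E v₀ + sum (λ x → 𝟙 (x ∈? T′) * avoiding x)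
      ≤⟨ +-mono-≤ (degree≤p v₀) (sum-mono-≤ (λ x → 𝟙*-monoʳ-≤ (x ∈? T′) avoiding≤)) ⟩
    p + sum (λ x → 𝟙 (x ∈? T′) * (p ∸ 1))
      ≡⟨ cong (p +_) (sym (*-distribʳ-sum (p ∸ 1) (λ x → 𝟙 (x ∈? T′)))) ⟩
    p + sum (λ x → 𝟙 (x ∈? T′)) * (p ∸ 1)
      ≡⟨ cong (λ z → p + z * (p ∸ 1)) (trans (sym (∣p∣≡sum𝟙∈ T′)) ∣T′∣) ⟩
    p + (p ∸ 1) * (p ∸ 1) ∎
    where
    open ≤-Reasoning
    v₀∈T : v₀ ∈ T
    v₀∈T = 𝟙>0⇒ (v₀ ∈? T) v₀>0
    T′ : Subset n
    T′ = T - v₀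
    ∣T′∣ : ∣ T′ ∣ ≡ p ∸ 1
    ∣T′∣ = trans (sym (m+n∸n≡m ∣ T′ ∣ 1))
                 (cong (_∸ 1) (trans (+-comm ∣ T′ ∣ 1) (trans (suc∣p-x∣≡∣p∣ v₀∈T) ∣T∣≡p)))
    missing containing : Fin m → Fin n → ℕ
    missing e x = 𝟙 (x ∈? E e) * 𝟙 (¬? (v₀ ∈? E e))
    containing e x = 𝟙 (x ∈? E e) * 𝟙 (v₀ ∈? E e)
    avoiding : Fin n → ℕ
    avoiding x = sum λ e → missing e x
    degree-split : ∀ x → degree E x ≡ sum (λ e → containing e x) + avoiding x
    degree-split x = trans (sum-cong-≗ split) (sum-distrib-+ (λ e → containing e x) (λ e → missing e x))
      where
      split : ∀ e → 𝟙 (x ∈? E e) ≡ containing e x + missing e x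
      split e = begin-equality
        𝟙 (x ∈? E e)                                               ≡⟨ *-identityʳ (𝟙 (x ∈? E e)) ⟨
        𝟙 (x ∈? E e) * 1                                           ≡⟨ cong (𝟙 (x ∈? E e) *_) (𝟙-¬ (v₀ ∈? E e)) ⟨
        𝟙 (x ∈? E e) * (𝟙 (v₀ ∈? E e) + 𝟙 (¬? (v₀ ∈? E e)))        ≡⟨ *-distribˡ-+ (𝟙 (x ∈? E e)) _ _ ⟩
        containing e x + missing e x                               ∎
    avoiding≤ : ∀ {x} → x ∈ T′ → avoiding x ≤ p ∸ 1
    avoiding≤ {x} x∈T′
      with joined x v₀ (λ cx≡cv₀ → x∈p-y⇒x≢y x∈T′ (multiColored x v₀ (p─q⊆p T ⁅ v₀ ⁆ x∈T′) v₀∈T cx≡cv₀))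
    ... | e , x∈e , v₀∈e = +-cancelʳ-≤ 1 (avoiding x) (p ∸ 1) (begin
      avoiding x + 1                                 ≤⟨ +-monoʳ-≤ (avoiding x) shared≥1 ⟩
      avoiding x + sum (λ e → containing e x)        ≡⟨ +-comm (avoiding x) _ ⟩
      sum (λ e → containing e x) + avoiding x        ≡⟨ degree-split x ⟨
      degree E x                                     ≤⟨ degree≤p x ⟩
      p                                              ≡⟨ m∸n+n≡m p>0 ⟨
      p ∸ 1 + 1                                      ∎)
      where
      shared≥1 : 1 ≤ sum (λ e → containing e x)
      shared≥1 = ≤-trans (≤-reflexive (sym (cong₂ _*_ (𝟙-yes (x ∈? E e) x∈e) (𝟙-yes (v₀ ∈? E e) v₀∈e))))
                         (f≤sum (λ e → containing e x) e)
    covered≤ : ∀ e → 𝟙 (nonempty? (E e ∩ T)) ≤ 𝟙 (v₀ ∈? E e) + sum (λ x → 𝟙 (x ∈? T′) * missing e x)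
    covered≤ e = ≤1∧>0⇒≤ (𝟙≤1 (nonempty? (E e ∩ T))) λ covered>0 →
      witness (𝟙>0⇒ (nonempty? (E e ∩ T)) covered>0) (v₀ ∈? E e)
      where
      witness : Nonempty (E e ∩ T) → Dec (v₀ ∈ E e) → 0 < 𝟙 (v₀ ∈? E e) + sum (λ x → 𝟙 (x ∈? T′) * missing e x)
      witness _ (yes v₀∈e) = ≤-trans (≤-reflexive (sym (𝟙-yes (v₀ ∈? E e) v₀∈e))) (m≤m+n _ _)
      witness (y , y∈) (no v₀∉e) with x∈p∩q⁻ (E e) T y∈
      ... | y∈e , y∈T = ≤-trans (≤-reflexive (sym one)) (≤-trans (f≤sum (λ x → 𝟙 (x ∈? T′) * missing e x) y) (m≤n+m _ _))
        where
        one : 𝟙 (y ∈? T′) * missing e y ≡ 1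
        one = cong₂ _*_ (𝟙-yes (y ∈? T′) (x∈p∧x≢y⇒x∈p-y y∈T (λ { refl → v₀∉e y∈e })))
                        (cong₂ _*_ (𝟙-yes (y ∈? E e) y∈e) (𝟙-yes (¬? (v₀ ∈? E e)) v₀∉e))

module Modular (q : ℕ) where

  p : ℕ
  p = suc q

  infix 4 _≈_
  _≈_ : ℕ → ℕ → Set
  a ≈ b = a % p ≡ b % p

  +-cong-≈ : ∀ {a a′ b b′} → a ≈ a′ → b ≈ b′ → a + b ≈ a′ + b′
  +-cong-≈ {a} {a′} {b} {b′} a≈a′ b≈b′ =
    trans (%-distribˡ-+ a b p) (trans (cong₂ (λ x y → (x + y) % p) a≈a′ b≈b′) (sym (%-distribˡ-+ a′ b′ p)))

  *-cong-≈ : ∀ {a a′ b b′} → a ≈ a′ → b ≈ b′ → a * b ≈ a′ * b′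
  *-cong-≈ {a} {a′} {b} {b′} a≈a′ b≈b′ =
    trans (%-distribˡ-* a b p) (trans (cong₂ (λ x y → (x * y) % p) a≈a′ b≈b′) (sym (%-distribˡ-* a′ b′ p)))

  %≈ : ∀ a → a % p ≈ a
  %≈ a = m%n%n≡m%n a p

  +kp≈ : ∀ a k → a + k * p ≈ a
  +kp≈ a k = [m+kn]%n≡m%n a k p

  ≈⇒≡ : ∀ {a b} → a < p → b < p → a ≈ b → a ≡ b
  ≈⇒≡ {a} {b} a<p b<p a≈b = trans (sym (m<n⇒m%n≡m a<p)) (trans a≈b (m<n⇒m%n≡m b<p))

  -- q * c plays the role of - c
  ≈-cancelʳ-+ : ∀ {a b} c → a + c ≈ b + c → a ≈ b
  ≈-cancelʳ-+ {a} {b} c a+c≈b+c = begin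
    a % p                   ≡⟨ +kp≈ a c ⟨
    (a + c * p) % p         ≡⟨ cong (_% p) (negate q a c) ⟩
    (a + c + q * c) % p     ≡⟨ +-cong-≈ {a + c} {b + c} {q * c} {q * c} a+c≈b+c refl ⟩
    (b + c + q * c) % p     ≡⟨ cong (_% p) (negate q b c) ⟨
    (b + c * p) % p         ≡⟨ +kp≈ b c ⟩
    b % p                   ∎
    where
    open ≡-Reasoning
    negate : ∀ q a c → a + c * suc q ≡ a + c + q * c
    negate = solve-∀

  ∃-difference : ∀ a u → ∃ λ y → y < p × y + u ≈ a
  ∃-difference a u = (a + q * u) % p , m%n<n (a + q * u) p , (begin
    ((a + q * u) % p + u) % p   ≡⟨ +-cong-≈ {(a + q * u) % p} {a + q * u} {u} (%≈ (a + q * u)) refl ⟩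
    (a + q * u + u) % p         ≡⟨ cong (_% p) (negate q a u) ⟩
    (a + u * p) % p             ≡⟨ +kp≈ a u ⟩
    a % p                       ∎)
    where
    open ≡-Reasoning
    negate : ∀ q a u → a + q * u + u ≡ a + u * suc q
    negate = solve-∀

  module _ (p-prime : Prime p) where

    ∃-inverse : ∀ δ → ¬ δ ≈ 0 → ∃ λ e → e * δ ≈ 1
    ∃-inverse δ δ≉0 with δ % p in δ%p≡
    ... | zero    = ⊥-elim (δ≉0 refl)
    ... | suc δ′  with coprime-Bézout (prime⇒coprime p-prime (subst (_< p) δ%p≡ (m%n<n δ p)))
    ...   | Bézout.Identity.-+ x y eq = y , (begin
      (y * δ) % p               ≡⟨ *-cong-≈ {y} {y} {δ} {δ % p} refl (sym (%≈ δ)) ⟩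
      (y * (δ % p)) % p         ≡⟨ cong (λ z → (y * z) % p) δ%p≡ ⟩
      (y * suc δ′) % p          ≡⟨ cong (_% p) eq ⟨
      (1 + x * p) % p           ≡⟨ +kp≈ 1 x ⟩
      1 % p                     ∎)
      where open ≡-Reasoning
    ...   | Bézout.Identity.+- x y eq = q * y , (begin
      (q * y * δ) % p                 ≡⟨ +kp≈ (q * y * δ) 1 ⟨
      (q * y * δ + 1 * p) % p         ≡⟨ cong (_% p) (rearrange q y δ) ⟩
      (1 + q * (1 + y * δ)) % p       ≡⟨ +-cong-≈ {1} {1} {q * (1 + y * δ)} {q * (x * p)} refl (*-cong-≈ {q} {q} refl 1+yδ≈xp) ⟩
      (1 + q * (x * p)) % p           ≡⟨ cong (λ z → (1 + z) % p) (*-assoc q x p) ⟨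
      (1 + q * x * p) % p             ≡⟨ +kp≈ 1 (q * x) ⟩
      1 % p                           ∎)
      where
      open ≡-Reasoning
      rearrange : ∀ q y δ → q * y * δ + 1 * suc q ≡ 1 + q * (1 + y * δ)
      rearrange = solve-∀
      1+yδ≈xp : 1 + y * δ ≈ x * p
      1+yδ≈xp = begin
        (1 + y * δ) % p
          ≡⟨ +-cong-≈ {1} {1} {y * δ} {y * suc δ′} refl (*-cong-≈ {y} {y} refl (trans (sym (%≈ δ)) (cong (_% p) δ%p≡))) ⟩
        (1 + y * suc δ′) % p  ≡⟨ cong (_% p) eq ⟩
        (x * p) % p           ∎

    -- k = (v - u) / (a - b)
    ∃-solution : ∀ u v a b → ¬ a ≈ b → ∃ λ k → k < p × u + k * a ≈ v + k * b
    ∃-solution u v a b a≉b with ∃-inverse (a + q * b) a-b≉0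
      where
      a-b≉0 : ¬ (a + q * b) ≈ 0
      a-b≉0 a-b≈0 = a≉b (sym (begin
        b % p                 ≡⟨ cong (_% p) (+-identityˡ b) ⟨
        (0 + b) % p           ≡⟨ +-cong-≈ {0} {a + q * b} {b} {b} (sym a-b≈0) refl ⟩
        (a + q * b + b) % p   ≡⟨ cong (_% p) (rearrange q a b) ⟩
        (a + b * p) % p       ≡⟨ +kp≈ a b ⟩
        a % p                 ∎))
        where
        open ≡-Reasoning
        rearrange : ∀ q a b → a + q * b + b ≡ a + b * suc q
        rearrange = solve-∀
    ... | e , e[a-b]≈1 = k , m%n<n k₀ p , ≈-cancelʳ-+ {u + k * a} {v + k * b} (k * (q * b)) (begin
      (u + k * a + k * (q * b)) % p            ≡⟨ cong (_% p) (r₁ q u k a b) ⟩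
      (u + k * (a + q * b)) % p                ≡⟨ +-cong-≈ {u} {u} refl (*-cong-≈ {k} {k₀} {a + q * b} {a + q * b} (%≈ k₀) refl) ⟩
      (u + k₀ * (a + q * b)) % p               ≡⟨ cong (λ z → (u + z) % p) (r₂ e (v + q * u) (a + q * b)) ⟩
      (u + (v + q * u) * (e * (a + q * b))) % p ≡⟨ +-cong-≈ {u} {u} refl (*-cong-≈ {v + q * u} {v + q * u} refl e[a-b]≈1) ⟩
      (u + (v + q * u) * 1) % p                ≡⟨ cong (_% p) (r₃ q u v) ⟩
      (v + u * p) % p                          ≡⟨ +kp≈ v u ⟩
      v % p                                    ≡⟨ +kp≈ v (k * b) ⟨
      (v + k * b * p) % p                      ≡⟨ cong (_% p) (r₄ q v k b) ⟩
      (v + k * b + k * (q * b)) % p            ∎)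
      where
      open ≡-Reasoning
      k₀ = e * (v + q * u)
      k = k₀ % p
      r₁ : ∀ q u k a b → u + k * a + k * (q * b) ≡ u + k * (a + q * b)
      r₁ = solve-∀
      r₂ : ∀ e w d → e * w * d ≡ w * (e * d)
      r₂ = solve-∀
      r₃ : ∀ q u v → u + (v + q * u) * 1 ≡ v + u * suc q
      r₃ = solve-∀
      r₄ : ∀ q v k b → v + k * b * suc q ≡ v + k * b + k * (q * b)
      r₄ = solve-∀

∃-prime≥ : ∀ r₀ → ∃ λ p → r₀ ≤ p × Prime p
∃-prime≥ r₀ with factorise (suc (r₀ !))
... | record { factors = List.[] ; isFactorisation = N≡1 } = ⊥-elim (<-irrefl (sym (suc-injective N≡1)) (1≤n! r₀))
... | record { factors = zero List.∷ _ ; factorsPrime = p-prime All.∷ _ } =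
  ⊥-elim (≢-nonZero⁻¹ 0 {{prime⇒nonZero p-prime}} refl)
... | record { factors = suc q List.∷ fs ; isFactorisation = N≡ ; factorsPrime = p-prime All.∷ _ } with suc q ≤? r₀
...   | no  p≰r₀ = suc q , <⇒≤ (≰⇒> p≰r₀) , p-prime
...   | yes p≤r₀ = ⊥-elim (<-irrefl (sym (∣1⇒≡1 p∣1)) (nonTrivial⇒n>1 (suc q) {{prime⇒nonTrivial p-prime}}))
  where
  p∣r₀! : suc q ∣ r₀ !
  p∣r₀! = ∣-trans (n∣m*n (q !) {suc q}) (subst (_∣ r₀ !) (*-comm (suc q) (q !)) (m≤n⇒m!∣n! p≤r₀))
  p∣1 : suc q ∣ 1
  p∣1 = ∣m+n∣m⇒∣n (subst (suc q ∣_) (trans (sym N≡) (+-comm 1 (r₀ !))) (m∣m*n (product fs))) p∣r₀!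

-- The dual of the affine plane over ℤ/p: hyperedges are the points (x, y), vertices are the
-- lines, coloured by direction; direction k < p holds the lines y + k x = b and direction p
-- the vertical lines x = b.
module DualAffinePlane (q : ℕ) (p-prime : Prime (suc q)) where

  open Modular q

  opaque
    intercept : Fin (suc p) → Fin p → Fin p → ℕ
    intercept k x y with toℕ k <? p
    ... | yes _ = (toℕ y + toℕ k * toℕ x) % p
    ... | no  _ = toℕ x

    intercept-slope : ∀ k x y → toℕ k < p → intercept k x y ≡ (toℕ y + toℕ k * toℕ x) % p
    intercept-slope k x y k<p with toℕ k <? p
    ... | yes _   = refl
    ... | no  k≮p = ⊥-elim (k≮p k<p)

    intercept-vertical : ∀ k x y → ¬ toℕ k < p → intercept k x y ≡ toℕ x
    intercept-vertical k x y k≮p with toℕ k <? p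
    ... | yes k<p = ⊥-elim (k≮p k<p)
    ... | no  _   = refl

    intercept<p : ∀ k x y → intercept k x y < p
    intercept<p k x y with toℕ k <? p
    ... | yes _ = m%n<n (toℕ y + toℕ k * toℕ x) p
    ... | no  _ = toℕ<n x

  vertical : Fin (suc p)
  vertical = fromℕ p

  vertical-unique : ∀ k → ¬ toℕ k < p → k ≡ vertical
  vertical-unique k k≮p = toℕ-injective (trans (≤-antisym (≤-pred (toℕ<n k)) (≮⇒≥ k≮p)) (sym (toℕ-fromℕ p)))

  slope : ∀ {k} → k < p → Fin (suc p)
  slope k<p = fromℕ< (m<n⇒m<1+n k<p)

  toℕ-slope : ∀ {k} (k<p : k < p) → toℕ (slope k<p) ≡ k
  toℕ-slope k<p = toℕ-fromℕ< (m<n⇒m<1+n k<p)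

  slope<p : ∀ {k} (k<p : k < p) → toℕ (slope k<p) < p
  slope<p k<p = subst (_< p) (sym (toℕ-slope k<p)) k<p

  nV nE : ℕ
  nV = suc p * p
  nE = p * p

  opaque
    direction : Fin nV → Fin (suc p)
    direction v = proj₁ (remQuot {suc p} p v)

    value : Fin nV → Fin p
    value v = proj₂ (remQuot {suc p} p v)

    px py : Fin nE → Fin p
    px e = proj₁ (remQuot {p} p e)
    py e = proj₂ (remQuot {p} p e)

    px-combine : ∀ (x y : Fin p) → px (combine x y) ≡ x
    px-combine x y = cong proj₁ (remQuot-combine {p} {p} x y)

    py-combine : ∀ (x y : Fin p) → py (combine x y) ≡ y
    py-combine x y = cong proj₂ (remQuot-combine {p} {p} x y)

    direction-line : ∀ (k : Fin (suc p)) (b : Fin p) → direction (combine k b) ≡ k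
    direction-line k b = cong proj₁ (remQuot-combine {suc p} {p} k b)

    value-line : ∀ (k : Fin (suc p)) (b : Fin p) → value (combine k b) ≡ b
    value-line k b = cong proj₂ (remQuot-combine {suc p} {p} k b)

    line-direction-value : ∀ (v : Fin nV) → combine (direction v) (value v) ≡ v
    line-direction-value v = combine-remQuot {suc p} p v

  On : Fin nE → Fin nV → Set
  On e v = toℕ (value v) ≡ intercept (direction v) (px e) (py e)

  on? : ∀ e v → Dec (On e v)
  on? e v = toℕ (value v) ≟ intercept (direction v) (px e) (py e)

  lines : Edges nV nE
  lines e = subset (on? e)

  ∈lines⁺ : ∀ {e v} → On e v → v ∈ lines e
  ∈lines⁺ {e} = ∈-subset⁺ (on? e)

  on-point : ∀ {v} (x y : Fin p) → intercept (direction v) x y ≡ toℕ (value v) → v ∈ lines (combine x y)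
  on-point {v} x y on = ∈lines⁺ (sym (trans (cong₂ (intercept (direction v)) (px-combine x y) (py-combine x y)) on))

  ∈lines⁻ : ∀ {e v} → v ∈ lines e → On e v
  ∈lines⁻ {e} = ∈-subset⁻ (on? e)

  surjective : Surjective direction
  surjective k = combine k zero , direction-line k zero

  partite : Partite direction lines
  partite e v w v∈ w∈ same-direction = begin
    v                                ≡⟨ line-direction-value v ⟨
    combine (direction v) (value v)     ≡⟨ cong₂ combine same-direction same-value ⟩
    combine (direction w) (value w)     ≡⟨ line-direction-value w ⟩
    w                                ∎
    where
    open ≡-Reasoning
    same-value : value v ≡ value w
    same-value = toℕ-injective (trans (∈lines⁻ v∈)
                   (trans (cong (λ k → intercept k (px e) (py e)) same-direction) (sym (∈lines⁻ w∈))))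

  sum-𝟙≟toℕ : ∀ {L} → L < p → sum (λ (b : Fin p) → 𝟙 (toℕ b ≟ L)) ≡ 1
  sum-𝟙≟toℕ {L} L<p =
    trans (sum-cong-≗ (λ b → 𝟙-cong (toℕ b ≟ L) (b ≟ᶠ fromℕ< L<p) to (from b))) (sum-𝟙≟ (fromℕ< L<p))
    where
    to : ∀ {b} → toℕ b ≡ L → b ≡ fromℕ< L<p
    to b≡L = toℕ-injective (trans b≡L (sym (toℕ-fromℕ< L<p)))
    from : ∀ b → b ≡ fromℕ< L<p → toℕ b ≡ L
    from b refl = toℕ-fromℕ< L<p

  uniform : Uniform (suc p) lines
  uniform e = begin
    ∣ lines e ∣
      ≡⟨ ∣subset∣ (on? e) ⟩
    sum (λ v → 𝟙 (on? e v))
      ≡⟨ sum-combine (suc p) p (λ v → 𝟙 (on? e v)) ⟩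
    sum (λ (k : Fin (suc p)) → sum (λ (b : Fin p) → 𝟙 (on? e (combine k b))))
      ≡⟨ sum-cong-≗ (λ k → trans (sum-cong-≗ (λ b → 𝟙-cong (on? e (combine k b)) (toℕ b ≟ intercept k (px e) (py e))
                                                             (at-line k b) (from-line k b)))
                                 (sum-𝟙≟toℕ (intercept<p k (px e) (py e)))) ⟩
    sum {suc p} (λ _ → 1)
      ≡⟨ trans (sum-const (suc p) 1) (*-identityʳ (suc p)) ⟩
    suc p ∎
    where
    open ≡-Reasoning
    at-line : ∀ (k : Fin (suc p)) (b : Fin p) → On e (combine k b) → toℕ b ≡ intercept k (px e) (py e)
    at-line k b = subst₂ (λ b′ k′ → toℕ b′ ≡ intercept k′ (px e) (py e)) (value-line k b) (direction-line k b)
    from-line : ∀ (k : Fin (suc p)) (b : Fin p) → toℕ b ≡ intercept k (px e) (py e) → On e (combine k b)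
    from-line k b = subst₂ (λ b′ k′ → toℕ b′ ≡ intercept k′ (px e) (py e))
                      (sym (value-line k b)) (sym (direction-line k b))

  common-line : ∀ e₁ e₂ k → intercept k (px e₁) (py e₁) ≡ intercept k (px e₂) (py e₂) → Nonempty (lines e₁ ∩ lines e₂)
  common-line e₁ e₂ k same = combine k b , x∈p∩q⁺ (on e₁ refl , on e₂ same)
    where
    b<p = intercept<p k (px e₁) (py e₁)
    b = fromℕ< b<p
    on : ∀ e → intercept k (px e₁) (py e₁) ≡ intercept k (px e) (py e) → combine k b ∈ lines e
    on e same′ = ∈lines⁺ (begin
        toℕ (value (combine k b))                                ≡⟨ cong toℕ (value-line k b) ⟩
        toℕ b                                                 ≡⟨ toℕ-fromℕ< b<p ⟩
        intercept k (px e₁) (py e₁)                           ≡⟨ same′ ⟩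
        intercept k (px e) (py e)                             ≡⟨ cong (λ k → intercept k (px e) (py e)) (direction-line k b) ⟨
        intercept (direction (combine k b)) (px e) (py e)        ∎)
      where open ≡-Reasoning

  -- two points with distinct x lie on a line of slope (y₂ - y₁) / (x₁ - x₂)
  intersecting : Intersecting lines
  intersecting e₁ e₂ with toℕ (px e₁) ≟ toℕ (px e₂)
  ... | yes same-x = common-line e₁ e₂ vertical (begin
    intercept vertical (px e₁) (py e₁)   ≡⟨ intercept-vertical vertical (px e₁) (py e₁) vertical≮p ⟩
    toℕ (px e₁)                          ≡⟨ same-x ⟩
    toℕ (px e₂)                          ≡⟨ intercept-vertical vertical (px e₂) (py e₂) vertical≮p ⟨
    intercept vertical (px e₂) (py e₂)   ∎)
    where
    open ≡-Reasoning
    vertical≮p : ¬ toℕ vertical < p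
    vertical≮p = <-irrefl (toℕ-fromℕ p)
  ... | no distinct-x = through-slope (∃-solution p-prime (toℕ (py e₁)) (toℕ (py e₂)) (toℕ (px e₁)) (toℕ (px e₂))
                                        (λ x₁≈x₂ → distinct-x (≈⇒≡ (toℕ<n (px e₁)) (toℕ<n (px e₂)) x₁≈x₂)))
    where
    through-slope : (∃ λ k → k < p × toℕ (py e₁) + k * toℕ (px e₁) ≈ toℕ (py e₂) + k * toℕ (px e₂)) →
                    Nonempty (lines e₁ ∩ lines e₂)
    through-slope (k , k<p , solves) = common-line e₁ e₂ (slope k<p) (begin
      intercept (slope k<p) (px e₁) (py e₁)                  ≡⟨ intercept-slope (slope k<p) (px e₁) (py e₁) (slope<p k<p) ⟩
      (toℕ (py e₁) + toℕ (slope k<p) * toℕ (px e₁)) % p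
        ≡⟨ cong (λ z → (toℕ (py e₁) + z * toℕ (px e₁)) % p) (toℕ-slope k<p) ⟩
      (toℕ (py e₁) + k * toℕ (px e₁)) % p                    ≡⟨ solves ⟩
      (toℕ (py e₂) + k * toℕ (px e₂)) % p
        ≡⟨ cong (λ z → (toℕ (py e₂) + z * toℕ (px e₂)) % p) (toℕ-slope k<p) ⟨
      (toℕ (py e₂) + toℕ (slope k<p) * toℕ (px e₂)) % p      ≡⟨ intercept-slope (slope k<p) (px e₂) (py e₂) (slope<p k<p) ⟨
      intercept (slope k<p) (px e₂) (py e₂)                  ∎)
      where open ≡-Reasoning

  points-on-line≤p : ∀ k b → sum (λ (x : Fin p) → sum (λ (y : Fin p) → 𝟙 (b ≟ intercept k x y))) ≤ p
  points-on-line≤p k b with toℕ k <? p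
  ... | yes k<p = begin
    sum (λ (x : Fin p) → sum (λ (y : Fin p) → 𝟙 (b ≟ intercept k x y)))
      ≤⟨ sum-mono-≤ (λ x → sum-≤1 (λ y → 𝟙 (b ≟ intercept k x y)) (λ y → 𝟙≤1 (b ≟ intercept k x y)) (unique-y x)) ⟩
    sum {p} (λ _ → 1)                                  ≡⟨ trans (sum-const p 1) (*-identityʳ p) ⟩
    p                                                  ∎
    where
    open ≤-Reasoning
    unique-y : ∀ (x y y′ : Fin p) → 0 < 𝟙 (b ≟ intercept k x y) → 0 < 𝟙 (b ≟ intercept k x y′) → y ≡ y′
    unique-y x y y′ on on′ =
      toℕ-injective (≈⇒≡ (toℕ<n y) (toℕ<n y′) (≈-cancelʳ-+ {toℕ y} {toℕ y′} (toℕ k * toℕ x) (begin-equality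
      (toℕ y + toℕ k * toℕ x) % p     ≡⟨ intercept-slope k x y k<p ⟨
      intercept k x y                 ≡⟨ 𝟙>0⇒ (b ≟ intercept k x y) on ⟨
      b                               ≡⟨ 𝟙>0⇒ (b ≟ intercept k x y′) on′ ⟩
      intercept k x y′                ≡⟨ intercept-slope k x y′ k<p ⟩
      (toℕ y′ + toℕ k * toℕ x) % p    ∎)))
  ... | no k≮p = begin
    sum (λ (x : Fin p) → sum (λ (y : Fin p) → 𝟙 (b ≟ intercept k x y)))
      ≡⟨ sum-cong-≗ (λ x → sum-cong-≗ {p} (λ y → cong (λ z → 𝟙 (b ≟ z)) (intercept-vertical k x y k≮p))) ⟩
    sum (λ (x : Fin p) → sum {p} (λ _ → 𝟙 (b ≟ toℕ x)))
      ≡⟨ sum-cong-≗ (λ (x : Fin p) → sum-const p (𝟙 (b ≟ toℕ x))) ⟩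
    sum (λ (x : Fin p) → p * 𝟙 (b ≟ toℕ x))                     ≡⟨ *-distribˡ-sum p (λ (x : Fin p) → 𝟙 (b ≟ toℕ x)) ⟨
    p * sum (λ (x : Fin p) → 𝟙 (b ≟ toℕ x))
      ≤⟨ *-monoʳ-≤ p (sum-≤1 (λ x → 𝟙 (b ≟ toℕ x)) (λ x → 𝟙≤1 (b ≟ toℕ x)) unique-x) ⟩
    p * 1                                             ≡⟨ *-identityʳ p ⟩
    p                                                 ∎
    where
    open ≤-Reasoning
    unique-x : ∀ (x x′ : Fin p) → 0 < 𝟙 (b ≟ toℕ x) → 0 < 𝟙 (b ≟ toℕ x′) → x ≡ x′
    unique-x x x′ on on′ = toℕ-injective (trans (sym (𝟙>0⇒ (b ≟ toℕ x) on)) (𝟙>0⇒ (b ≟ toℕ x′) on′))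

  degree≤p : ∀ v → degree lines v ≤ p
  degree≤p v = begin
    sum (λ e → 𝟙 (v ∈? lines e))
      ≡⟨ sum-cong-≗ (λ e → 𝟙-cong (v ∈? lines e) (on? e v) ∈lines⁻ ∈lines⁺) ⟩
    sum (λ e → 𝟙 (on? e v))
      ≡⟨ sum-combine p p (λ e → 𝟙 (on? e v)) ⟩
    sum (λ (x : Fin p) → sum (λ (y : Fin p) → 𝟙 (on? (combine x y) v)))
      ≡⟨ sum-cong-≗ (λ x → sum-cong-≗ (λ y →
           cong₂ (λ x′ y′ → 𝟙 (b ≟ intercept k x′ y′)) (px-combine x y) (py-combine x y))) ⟩
    sum (λ (x : Fin p) → sum (λ (y : Fin p) → 𝟙 (b ≟ intercept k x y)))
      ≤⟨ points-on-line≤p k b ⟩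
    p ∎
    where
    open ≤-Reasoning
    k = direction v
    b = toℕ (value v)

  on-vertical : ∀ v (y : Fin p) → ¬ toℕ (direction v) < p → v ∈ lines (combine (value v) y)
  on-vertical v y k≮p = on-point (value v) y (intercept-vertical (direction v) (value v) y k≮p)

  on-slope : ∀ w (x : Fin p) {y} (y<p : y < p) → toℕ (direction w) < p →
    y + toℕ (direction w) * toℕ x ≈ toℕ (value w) → w ∈ lines (combine x (fromℕ< y<p))
  on-slope w x {y} y<p k<p on = on-point x (fromℕ< y<p) (begin
    intercept (direction w) x (fromℕ< y<p)                        ≡⟨ intercept-slope (direction w) x (fromℕ< y<p) k<p ⟩
    (toℕ (fromℕ< y<p) + toℕ (direction w) * toℕ x) % p
      ≡⟨ cong (λ z → (z + toℕ (direction w) * toℕ x) % p) (toℕ-fromℕ< y<p) ⟩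
    (y + toℕ (direction w) * toℕ x) % p                           ≡⟨ on ⟩
    toℕ (value w) % p                                             ≡⟨ m<n⇒m%n≡m (toℕ<n (value w)) ⟩
    toℕ (value w)                                                 ∎)
    where open ≡-Reasoning

  vertical-meets-slope : ∀ v w → ¬ toℕ (direction v) < p → toℕ (direction w) < p → ∃ λ e → v ∈ lines e × w ∈ lines e
  vertical-meets-slope v w k≮p k′<p = meet (∃-difference (toℕ (value w)) (toℕ (direction w) * toℕ (value v)))
    where
    meet : (∃ λ y → y < p × y + toℕ (direction w) * toℕ (value v) ≈ toℕ (value w)) →
           ∃ λ e → v ∈ lines e × w ∈ lines e
    meet (y , y<p , on) = combine (value v) (fromℕ< y<p) , on-vertical v (fromℕ< y<p) k≮p , on-slope w (value v) y<p k′<p on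

  -- the lines y + k x = b and y + k′ x = b′ with k ≠ k′ meet at x = (b - b′) / (k - k′)
  slopes-meet : ∀ v w → toℕ (direction v) < p → toℕ (direction w) < p → direction v ≢ direction w →
    ∃ λ e → v ∈ lines e × w ∈ lines e
  slopes-meet v w k<p k′<p k≢k′ =
    meet (∃-solution p-prime b′ b k k′ (λ k≈k′ → k≢k′ (toℕ-injective (≈⇒≡ k<p k′<p k≈k′))))
    where
    k = toℕ (direction v)
    k′ = toℕ (direction w)
    b = toℕ (value v)
    b′ = toℕ (value w)
    meet-at : ∀ {x} (x<p : x < p) → b′ + x * k ≈ b + x * k′ → (∃ λ y → y < p × y + k * x ≈ b) →
              ∃ λ e → v ∈ lines e × w ∈ lines e
    meet-at {x} x<p crossing (y , y<p , on-v) =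
      combine X (fromℕ< y<p) , on-slope v X y<p k<p (subst (λ z → y + k * z ≈ b) (sym toℕ-X) on-v)
                             , on-slope w X y<p k′<p (subst (λ z → y + k′ * z ≈ b′) (sym toℕ-X) on-w)
      where
      X = fromℕ< x<p
      toℕ-X : toℕ X ≡ x
      toℕ-X = toℕ-fromℕ< x<p
      on-w : y + k′ * x ≈ b′
      on-w = ≈-cancelʳ-+ {y + k′ * x} {b′} (k * x) (begin
        (y + k′ * x + k * x) % p     ≡⟨ cong (_% p) (r₁ y k k′ x) ⟩
        (y + k * x + k′ * x) % p     ≡⟨ +-cong-≈ {y + k * x} {b} {k′ * x} {k′ * x} on-v refl ⟩
        (b + k′ * x) % p             ≡⟨ cong (_% p) (cong (b +_) (*-comm k′ x)) ⟩
        (b + x * k′) % p             ≡⟨ crossing ⟨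
        (b′ + x * k) % p             ≡⟨ cong (_% p) (cong (b′ +_) (*-comm x k)) ⟩
        (b′ + k * x) % p             ∎)
        where
        open ≡-Reasoning
        r₁ : ∀ y k k′ x → y + k′ * x + k * x ≡ y + k * x + k′ * x
        r₁ = solve-∀
    meet : (∃ λ x → x < p × b′ + x * k ≈ b + x * k′) → ∃ λ e → v ∈ lines e × w ∈ lines e
    meet (x , x<p , crossing) = meet-at x<p crossing (∃-difference b (k * x))

  joined : ∀ v w → direction v ≢ direction w → ∃ λ e → v ∈ lines e × w ∈ lines e
  joined v w k≢k′ with toℕ (direction v) <? p | toℕ (direction w) <? p
  ... | yes k<p | yes k′<p = slopes-meet v w k<p k′<p k≢k′
  ... | no  k≮p | yes k′<p = vertical-meets-slope v w k≮p k′<p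
  ... | yes k<p | no  k′≮p = let e , w∈ , v∈ = vertical-meets-slope w v k′≮p k<p in e , v∈ , w∈
  ... | no  k≮p | no  k′≮p = ⊥-elim (k≢k′ (trans (vertical-unique _ k≮p) (sym (vertical-unique _ k′≮p))))

sharpness : ∀ (r₀ : ℕ) → ∃ λ (r : ℕ) → r ≥ r₀ × r ≥ 2 ×
  Σ ℕ λ n → Σ ℕ λ m → Σ (Fin n → Fin r) λ c → Σ (Edges n m) λ E →
    IsRPartiteRUniformIntersecting r c E × m ≥ 1 ×
    (∀ (T : Subset n) → MultiColored c T → ∣ T ∣ ≡ r ∸ 1 → AtMostBound r m (coveredCount E T))
sharpness r₀ with ∃-prime≥ r₀
... | zero  , _     , p-prime = ⊥-elim (≢-nonZero⁻¹ 0 {{prime⇒nonZero p-prime}} refl)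
... | suc q , r₀≤p , p-prime = suc (suc q) , m≤n⇒m≤1+n r₀≤p , s≤s (s≤s z≤n) , nV , nE , direction , lines ,
      (surjective , partite , uniform , intersecting) , s≤s z≤n , bound
  where
  open DualAffinePlane q p-prime
  bound : ∀ T → MultiColored direction T → ∣ T ∣ ≡ suc q → AtMostBound (suc (suc q)) nE (coveredCount lines T)
  bound T multiColored ∣T∣ = begin
    coveredCount lines T * suc q ^ 2
      ≤⟨ *-monoˡ-≤ (suc q ^ 2) (coveredCount≤ direction lines degree≤p joined T multiColored ∣T∣ (s≤s z≤n)) ⟩
    (suc q + q * q) * suc q ^ 2              ≡⟨ cong₂ _*_ (sym (trans (cong (_∸ q) (square q)) (m+n∸n≡m _ q))) (square′ q) ⟩
    (suc q ^ 2 ∸ q) * (suc q * suc q)        ∎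
    where
    open ≤-Reasoning
    square : ∀ q → suc q * (suc q * 1) ≡ (suc q + q * q) + q
    square = solve-∀
    square′ : ∀ q → suc q * (suc q * 1) ≡ suc q * suc q
    square′ = solve-∀

theorem6 :
    -- main bound, with the "moreover" part (cover inside some hyperedge)
    (∀ (r n m : ℕ) → r ≥ 2 → (c : Fin n → Fin r) → (E : Edges n m) →
      IsRPartiteRUniformIntersecting r c E →
        (∃ λ (T : Subset n) → MultiColored c T × ∣ T ∣ ≡ r ∸ 1
                              × AtLeastBound r m (coveredCount E T))
        × (Fin m → ∃ λ (T : Subset n) → ∃ λ (i : Fin m) → T ⊆ E i
                              × MultiColored c T × ∣ T ∣ ≡ r ∸ 1
                              × AtLeastBound r m (coveredCount E T)))
    ×
    -- sharpness for infinitely many r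
    (∀ (r₀ : ℕ) → ∃ λ (r : ℕ) → r ≥ r₀ × r ≥ 2 ×
      Σ ℕ λ n → Σ ℕ λ m → Σ (Fin n → Fin r) λ c → Σ (Edges n m) λ E →
        IsRPartiteRUniformIntersecting r c E × m ≥ 1 ×
        (∀ (T : Subset n) → MultiColored c T → ∣ T ∣ ≡ r ∸ 1 →
           AtMostBound r m (coveredCount E T)))
theorem6 = lower-bound , sharpness
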